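{- Let $\mathcal{A}$ be a subspace arrangement embedded in the braid arrangement $\mathcal{S}_n$. Then \[ \frac{x\,\overline{h}(\mathcal{A},\mathcal{S}_n;x)}{(1-x)^{d(\mathcal{A})+2}}=\sum_{m\geq 0} m\,T(\mathcal{A};m)\,x^m. \]
   Context: The braid arrangement $\mathcal{S}_n$ is the arrangement in the $(n-1)$-dimensional space $V_n=\{(x_1,\dots,x_n)\in\mathbb{R}^n:\sum x_i=0\}$ of the hyperplanes $x_i=x_j$, $1\le i<j\le n$. Its intersection lattice $L_{\mathcal{S}_n}$ consists of all intersections of subfamilies of these hyperplanes, ordered by reverse inclusion. A subspace arrangement $\mathcal{A}$ (finite set of linear subspaces, none containing another) is embedded in $\mathcal{S}_n$ if it is an antichain in $L_{\mathcal{S}_n}$. $\Delta_{\mathcal{S}_n}$ is the simplicial decomposition of the unit sphere of $V_n$ whose cells are the sets of points with a common sign vector with respect to the hyperplanes of $\mathcal{S}_n$, and $\Delta_{\mathcal{A},\mathcal{S}_n}$ is its subcomplex formed by $(\bigcup\mathcal{A})$ intersected with the unit sphere. $d(\mathcal{A})=\max_{A\in\mathcal{A}}\dim A$, so $\Delta_{\mathcal{A},\mathcal{S}_n}$ has dimension $d(\mathcal{A})-1$. For a simplicial complex $\Delta$ of dimension $d-1$, $h(\Delta;x)=\sum_{i=0}^d f_{i-1}(x-1)^{d-i}$ ($f_i$ = number of $i$-faces, $f_{ -1}=1$ if nonempty), $\overline{h}(\Delta;x)=x^dh(\Delta;1/x)$, and $\overline{h}(\mathcal{A},\mathcal{S}_n;x)=\overline{h}(\Delta_{\mathcal{A},\mathcal{S}_n};x)$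 (taken to be $0$ if $\mathcal{A}=\emptyset$). The characteristic polynomial of $\mathcal{A}$ (as an arrangement in $V_n$) is $\chi(\mathcal{A};x)=\sum_{Y\in L_\mathcal{A}}\mu(V_n,Y)x^{\dim Y}$, where $L_\mathcal{A}$ is the lattice of intersections of subfamilies of $\mathcal{A}$ (least element $V_n$) ordered by reverse inclusion and $\mu$ its Möbius function. The tail is $T(\mathcal{A};x)=x^{n-1}-\chi(\mathcal{A};x)$. -}

module Defs where

open import Data.Bool using (Bool; true; false; _∧_; _∨_; not; if_then_else_; T)
open import Data.Nat as ℕ using (ℕ; zero; suc; _∸_; _⊔_; _<ᵇ_)
open import Data.Fin as Fin using (Fin; toℕ)
open import Data.Fin.Properties using () renaming (_≟_ to _≟ᶠ_)
open import Data.Integer as ℤ using (ℤ; +_; -_; _-_)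
open import Data.List as List
  using (List; []; _∷_; _++_; map; foldr; length; filterᵇ; allFin; concatMap; deduplicateᵇ; upTo; replicate; null)
open import Data.Bool.ListAction as BL using ()
open import Data.List.Relation.Unary.All using (All)
open import Data.List.Relation.Unary.AllPairs using (AllPairs)
open import Data.Vec as Vec using (Vec; lookup)
open import Data.Product using (_×_)
open import Relation.Nullary using (¬_)
open import Relation.Nullary.Decidable using (⌊_⌋)
open import Relation.Binary.PropositionalEquality using (_≡_)

-- An element of the intersection lattice L_{S_n} is a subspace
--   X_R = { x ∈ V_n : x_i = x_j whenever R i j }
-- for an equivalence relation R on Fin n (the flats are exactly these,
-- and R ↦ X_R is a bijection).  We represent a flat by its relation R.
-- X_R ⊆ X_S  iff  S ⊆ R ;  V_n = X_discrete ;  dim X_R = #blocks(R) - 1.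

FlatRel : ℕ → Set
FlatRel n = Fin n → Fin n → Bool

allᶠ : ∀ {n} → (Fin n → Bool) → Bool
allᶠ {n} p = BL.all p (allFin n)

anyᶠ : ∀ {n} → (Fin n → Bool) → Bool
anyᶠ {n} p = BL.any p (allFin n)

record IsEquivRel {n : ℕ} (R : FlatRel n) : Set where
  field
    rfl : ∀ i → T (R i i)
    sym : ∀ i j → T (R i j) → T (R j i)
    trn : ∀ i j k → T (R i j) → T (R j k) → T (R i k)

_⊆ᴿ_ : ∀ {n} → FlatRel n → FlatRel n → Set
R ⊆ᴿ S = ∀ i j → T (R i j) → T (S i j)

_⊆ᵇ_ : ∀ {n} → FlatRel n → FlatRel n → Bool
R ⊆ᵇ S = allᶠ λ i → allᶠ λ j → not (R i j) ∨ S i j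

_≈ᵇ_ : ∀ {n} → FlatRel n → FlatRel n → Bool
R ≈ᵇ S = (R ⊆ᵇ S) ∧ (S ⊆ᵇ R)

discrete : ∀ {n} → FlatRel n
discrete i j = ⌊ i ≟ᶠ j ⌋

isLeader : ∀ {n} → FlatRel n → Fin n → Bool
isLeader R i = allᶠ λ j → not ((toℕ j <ᵇ toℕ i) ∧ R j i)

blocks : ∀ {n} → FlatRel n → ℕ
blocks {n} R = length (filterᵇ (isLeader R) (allFin n))

dim : ∀ {n} → FlatRel n → ℕ
dim R = blocks R ∸ 1

-- intersection of two flats X_R ∩ X_S = X_{join R S}
-- (join = transitive closure of the union)
step : ∀ {n} → FlatRel n → FlatRel n
step R i j = R i j ∨ anyᶠ λ l → R i l ∧ R l j

iterStep : ∀ {n} → ℕ → FlatRel n → FlatRel n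
iterStep zero R = R
iterStep (suc k) R = iterStep k (step R)

meetFlat : ∀ {n} → FlatRel n → FlatRel n → FlatRel n
meetFlat {n} R S = iterStep n (λ i j → R i j ∨ S i j)

⋂ : ∀ {n} → List (FlatRel n) → FlatRel n
⋂ = foldr meetFlat discrete

-- Subspace arrangements embedded in S_n: a finite family of proper
-- subspaces (flats of S_n different from V_n) forming an antichain in L_{S_n}.

Proper : ∀ {n} → FlatRel n → Set
Proper R = ¬ (R ⊆ᴿ discrete)

Incomparable : ∀ {n} → FlatRel n → FlatRel n → Set
Incomparable R S = ¬ (R ⊆ᴿ S) × ¬ (S ⊆ᴿ R)

record Embedded {n : ℕ} (𝒜 : List (FlatRel n)) : Set where
  field
    flats     : All IsEquivRel 𝒜
    proper    : All Proper 𝒜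
    antichain : AllPairs Incomparable 𝒜

-- d(𝒜) = max dim (0 for the empty arrangement; irrelevant there)
dA : ∀ {n} → List (FlatRel n) → ℕ
dA = foldr (λ A m → dim A ⊔ m) 0

sublists : ∀ {a} {A : Set a} → List A → List (List A)
sublists [] = [] ∷ []
sublists (x ∷ xs) = sublists xs ++ map (x ∷_) (sublists xs)

LA : ∀ {n} → List (FlatRel n) → List (FlatRel n)
LA 𝒜 = deduplicateᵇ _≈ᵇ_ (map ⋂ (sublists 𝒜))

sumℤ : List ℤ → ℤ
sumℤ = foldr ℤ._+_ (+ 0)

-- μ(V_n, Y) in the poset L (order: Z ≤ Y iff Z ⊆ᵇ Y as relations,
-- i.e. reverse inclusion of subspaces), by the defining recursion
--   μ(V,V) = 1,  μ(V,Y) = - Σ_{V ≤ Z < Y} μ(V,Z),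
-- with a fuel argument (fuel ≥ n suffices since chains in L have < n+1 elements).
möbius : ∀ {n} → List (FlatRel n) → ℕ → FlatRel n → ℤ
möbius L zero Y = + 0
möbius L (suc f) Y =
  if Y ≈ᵇ discrete then + 1
  else - sumℤ (map (möbius L f) (filterᵇ (λ Z → (Z ⊆ᵇ Y) ∧ not (Z ≈ᵇ Y)) L))

χ : ∀ {n} → List (FlatRel n) → ℤ → ℤ
χ {n} 𝒜 m = sumℤ (map (λ Y → möbius (LA 𝒜) (suc n) Y ℤ.* (m ℤ.^ dim Y)) (LA 𝒜))

Tail : ∀ {n} → List (FlatRel n) → ℤ → ℤ
Tail {n} 𝒜 m = (m ℤ.^ (n ∸ 1)) - χ 𝒜 m

-- Cells of Δ_{S_n} (points with a common sign vector, on the unit sphere)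
-- correspond to ordered set partitions of Fin n into k ≥ 2 blocks, encoded
-- as surjections c : Fin n → Fin k (c i = position of the block of i;
-- sign(x_i - x_j) = sign(c i - c j)).  Such a cell has dimension k - 2.
-- It lies in X_R iff R i j implies c i = c j.

allFuns : (n k : ℕ) → List (Vec (Fin k) n)
allFuns zero k = Vec.[] ∷ []
allFuns (suc n) k = concatMap (λ v → map (Vec._∷ v) (allFin k)) (allFuns n k)

surj : ∀ {n k} → Vec (Fin k) n → Bool
surj c = allᶠ λ j → anyᶠ λ i → ⌊ lookup c i ≟ᶠ j ⌋

cellIn : ∀ {n k} → FlatRel n → Vec (Fin k) n → Bool
cellIn R c = allᶠ λ i → allᶠ λ j → not (R i j) ∨ ⌊ lookup c i ≟ᶠ lookup c j ⌋

inUnion : ∀ {n k} → List (FlatRel n) → Vec (Fin k) n → Bool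
inUnion 𝒜 c = BL.any (λ R → cellIn R c) 𝒜

cellCount : ∀ {n} → List (FlatRel n) → ℕ → ℕ
cellCount {n} 𝒜 k = length (filterᵇ (λ c → surj c ∧ inUnion 𝒜 c) (allFuns n k))

-- f_{i-1}(Δ_{𝒜,S_n}), with f_{-1} = 1
fm1 : ∀ {n} → List (FlatRel n) → ℕ → ℕ
fm1 𝒜 zero = 1
fm1 𝒜 (suc i) = cellCount 𝒜 (suc (suc i))

-- Polynomials over ℤ as coefficient lists (constant term first),
-- formal power series as ℕ → ℤ.

Poly : Set
Poly = List ℤ

_+ₚ_ : Poly → Poly → Poly
[] +ₚ q = q
(a ∷ p) +ₚ [] = a ∷ p
(a ∷ p) +ₚ (b ∷ q) = (a ℤ.+ b) ∷ (p +ₚ q)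

_*ₚ_ : Poly → Poly → Poly
[] *ₚ q = []
(a ∷ p) *ₚ q = map (a ℤ.*_) q +ₚ (+ 0 ∷ (p *ₚ q))

_^ₚ_ : Poly → ℕ → Poly
p ^ₚ zero = + 1 ∷ []
p ^ₚ suc k = p *ₚ (p ^ₚ k)

constₚ : ℤ → Poly
constₚ a = a ∷ []

Xpow : ℕ → Poly
Xpow i = replicate i (+ 0) ++ (+ 1 ∷ [])

oneMinusX : Poly
oneMinusX = + 1 ∷ - (+ 1) ∷ []

coeff : Poly → ℕ → ℤ
coeff [] i = + 0
coeff (a ∷ p) zero = a
coeff (a ∷ p) (suc i) = coeff p i

sumPoly : List Poly → Poly
sumPoly = foldr _+ₚ_ []

-- h̄(Δ;x) = x^d h(Δ;1/x) = Σ_{i=0}^{d} f_{i-1} (1-x)^{d-i} x^i,  d = d(𝒜);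
-- taken to be 0 for 𝒜 = ∅.
hbar : ∀ {n} → List (FlatRel n) → Poly
hbar 𝒜 =
  if null 𝒜 then []
  else sumPoly (map (λ i → constₚ (+ fm1 𝒜 i) *ₚ ((oneMinusX ^ₚ (dA 𝒜 ∸ i)) *ₚ Xpow i))
                    (upTo (suc (dA 𝒜))))

mulPS : Poly → (ℕ → ℤ) → ℕ → ℤ
mulPS p s m = sumℤ (map (λ i → coeff p i ℤ.* s (m ∸ i)) (upTo (suc m)))

{-# OPTIONS --safe #-}
-- Colour the coordinates with m colours, c : Fin n → Fin m. The point c lies on the flat of Y
-- iff Y ⊆ᴿ kernel c, and the colourings on it number m^{dim Y + 1}; so Möbius inversion over
-- L_𝒜 gives m·χ(𝒜;m) = #{c ∉ ⋃𝒜}, hence m·T(𝒜;m) = #{c ∈ ⋃𝒜}. Grouping colourings by the set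
-- of colours used, #{c ∈ ⋃𝒜} = Σ_k C(m,k)·g(k), where g(k) counts the surjective ones, i.e. the
-- cells of Δ_{𝒜,S_n} with k blocks (g(k) = f_{k-2}, vanishing for k > d(𝒜) + 1). Finally
-- Σ_m C(m,k) x^m = x^k / (1-x)^{k+1}, and multiplying by (1-x)^{d+2} leaves Σ_k g(k) x^k (1-x)^{d+1-k},
-- which is x·h̄.
module Submission where

open import Defs
open import Data.Bool using (Bool; true; false; _∧_; _∨_; not; if_then_else_; T)
open import Data.Bool.Properties using (T?; T-∧; T-∨)
open import Data.Bool.ListAction as BL using ()
open import Data.Empty using (⊥-elim)
open import Data.Fin as Fin using (Fin; toℕ; punchIn)
open import Data.Fin.Properties as Finₚ using (toℕ-injective) renaming (_≟_ to _≟ᶠ_)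
open import Data.Integer using (ℤ)
open import Data.List using (List; []; _∷_; _++_; map; length; filterᵇ; allFin; concatMap)
open import Data.List.Membership.Propositional using (_∈_; find; lose)
open import Data.List.Membership.Propositional.Properties using (∈-allFin)
open import Data.List.Relation.Unary.All as All using (All; []; _∷_)
open import Data.List.Relation.Unary.All.Properties using (all⁺; all⁻)
open import Data.List.Relation.Unary.AllPairs using (AllPairs; []; _∷_)
open import Data.List.Relation.Unary.Any using (here; there)
open import Data.List.Relation.Unary.Any.Properties using (any⁺; any⁻)
open import Data.Nat using (ℕ; zero; suc; _≤_; _<_; z≤n; s≤s)
open import Data.Product using (_×_; _,_; proj₁; proj₂; ∃-syntax)
open import Data.Sum using (_⊎_; inj₁; inj₂)
open import Data.Unit using (tt)
open import Data.Vec as Vec using (Vec; lookup)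
open import Function using (_∘_; id)
open import Function.Bundles using (Equivalence)
open import Relation.Nullary using (¬_; yes; no)
open import Relation.Nullary.Decidable using (⌊_⌋; toWitness; fromWitness)
open import Relation.Binary.PropositionalEquality using (_≡_; _≢_; refl; sym; trans; cong; cong₂; subst; subst₂; module ≡-Reasoning)
open import Relation.Binary.Structures using (IsEquivalence)

open Equivalence using (to; from)

module Booleans where

  open import Data.Fin.Properties using (¬∀⟶∃¬)

  T-ext : ∀ {a b} → (T a → T b) → (T b → T a) → a ≡ b
  T-ext {false} {false} _ _ = refl
  T-ext {false} {true}  _ g = ⊥-elim (g tt)
  T-ext {true}  {false} f _ = ⊥-elim (f tt)
  T-ext {true}  {true}  _ _ = refl

  allᶠ⁺ : ∀ {n} (p : Fin n → Bool) → (∀ i → T (p i)) → T (allᶠ p)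
  allᶠ⁺ {n} p h = all⁻ p {allFin n} (All.tabulate (λ {i} _ → h i))

  allᶠ⁻ : ∀ {n} (p : Fin n → Bool) → T (allᶠ p) → ∀ i → T (p i)
  allᶠ⁻ {n} p t i = All.lookup (all⁺ p (allFin n) t) (∈-allFin i)

  anyᶠ⁺ : ∀ {n} (p : Fin n → Bool) i → T (p i) → T (anyᶠ p)
  anyᶠ⁺ {n} p i t = any⁺ {xs = allFin n} p (lose (∈-allFin i) t)

  anyᶠ⁻ : ∀ {n} (p : Fin n → Bool) → T (anyᶠ p) → ∃[ i ] T (p i)
  anyᶠ⁻ {n} p t = let i , _ , pi = find (any⁻ p (allFin n) t) in i , pi

  allᶠ-witness : ∀ {n} (p : Fin n → Bool) → ¬ T (allᶠ p) → ∃[ i ] ¬ T (p i)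
  allᶠ-witness {n} p ¬all = ¬∀⟶∃¬ n (T ∘ p) (T? ∘ p) (¬all ∘ allᶠ⁺ p)

  not∨⇒→ : ∀ {a b} → T (not a ∨ b) → T a → T b
  not∨⇒→ {true} t _ = t

  →⇒not∨ : ∀ {a b} → (T a → T b) → T (not a ∨ b)
  →⇒not∨ {true}  h = h tt
  →⇒not∨ {false} h = tt

  ¬not∨⇒ : ∀ {a b} → ¬ T (not a ∨ b) → T a × ¬ T b
  ¬not∨⇒ {true}  ¬b = tt , ¬b
  ¬not∨⇒ {false} ¬t = ⊥-elim (¬t tt)

  ¬T⇒T-not : ∀ {b} → ¬ T b → T (not b)
  ¬T⇒T-not {false} _  = tt
  ¬T⇒T-not {true}  ¬t = ¬t tt

  T-not⇒¬T : ∀ {b} → T (not b) → ¬ T b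
  T-not⇒¬T {false} _ ()

  not∧⇒ : ∀ {a b} → T (not (a ∧ b)) → T a → ¬ T b
  not∧⇒ {true} {true} ()
  not∧⇒ {true} {false} _ _ ()

  ⇒not∧ : ∀ {a b} → (T a → ¬ T b) → T (not (a ∧ b))
  ⇒not∧ {true}  {true}  h = h tt tt
  ⇒not∧ {true}  {false} h = tt
  ⇒not∧ {false}         h = tt

module Counting where

  open import Data.Nat using (_+_; _*_; _^_)
  open import Data.Nat.Properties
  open import Data.List.Properties using (length-tabulate; map-tabulate)
  open import Algebra.Properties.CommutativeSemigroup +-commutativeSemigroup
    using () renaming (interchange to +-interchange)

  ⟦_⟧ : Bool → ℕ
  ⟦ true ⟧  = 1
  ⟦ false ⟧ = 0

  ⟦∧⟧ : ∀ a b → ⟦ a ∧ b ⟧ ≡ ⟦ a ⟧ * ⟦ b ⟧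
  ⟦∧⟧ true  b = sym (+-identityʳ ⟦ b ⟧)
  ⟦∧⟧ false b = refl

  ∑ : ∀ {a} {A : Set a} → List A → (A → ℕ) → ℕ
  ∑ []       f = 0
  ∑ (x ∷ xs) f = f x + ∑ xs f

  syntax ∑ xs (λ x → e) = ∑[ x ← xs ] e

  module _ {a} {A : Set a} where

    length-filterᵇ : (p : A → Bool) (xs : List A) → length (filterᵇ p xs) ≡ ∑[ x ← xs ] ⟦ p x ⟧
    length-filterᵇ p [] = refl
    length-filterᵇ p (x ∷ xs) with p x
    ... | true  = cong suc (length-filterᵇ p xs)
    ... | false = length-filterᵇ p xs

    ∑-cong-∈ : (xs : List A) {f g : A → ℕ} → (∀ {x} → x ∈ xs → f x ≡ g x) → ∑ xs f ≡ ∑ xs g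
    ∑-cong-∈ []       h = refl
    ∑-cong-∈ (x ∷ xs) h = cong₂ _+_ (h (here refl)) (∑-cong-∈ xs (h ∘ there))

    ∑-cong : (xs : List A) {f g : A → ℕ} → (∀ x → f x ≡ g x) → ∑ xs f ≡ ∑ xs g
    ∑-cong xs h = ∑-cong-∈ xs (λ {x} _ → h x)

    ∑-++ : (xs ys : List A) (f : A → ℕ) → ∑ (xs ++ ys) f ≡ ∑ xs f + ∑ ys f
    ∑-++ []       ys f = refl
    ∑-++ (x ∷ xs) ys f = trans (cong (f x +_) (∑-++ xs ys f)) (sym (+-assoc (f x) _ _))

    ∑-+ : (xs : List A) (f g : A → ℕ) → ∑[ x ← xs ] (f x + g x) ≡ ∑ xs f + ∑ xs g
    ∑-+ []       f g = refl
    ∑-+ (x ∷ xs) f g = trans (cong (f x + g x +_) (∑-+ xs f g)) (+-interchange (f x) (g x) _ _)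

    *-distribˡ-∑ : (c : ℕ) (xs : List A) (f : A → ℕ) → c * ∑ xs f ≡ ∑[ x ← xs ] (c * f x)
    *-distribˡ-∑ c []       f = *-zeroʳ c
    *-distribˡ-∑ c (x ∷ xs) f = trans (*-distribˡ-+ c (f x) _) (cong (c * f x +_) (*-distribˡ-∑ c xs f))

    ∑-zero : (xs : List A) → ∑[ x ← xs ] 0 ≡ 0
    ∑-zero []       = refl
    ∑-zero (x ∷ xs) = ∑-zero xs

    ∑-const : (xs : List A) (c : ℕ) → ∑[ x ← xs ] c ≡ length xs * c
    ∑-const []       c = refl
    ∑-const (x ∷ xs) c = cong (c +_) (∑-const xs c)

    ∑-⟦⟧-split : (xs : List A) (p q : A → Bool) →
      ∑[ x ← xs ] ⟦ p x ⟧ ≡ ∑[ x ← xs ] ⟦ p x ∧ q x ⟧ + ∑[ x ← xs ] ⟦ p x ∧ not (q x) ⟧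
    ∑-⟦⟧-split xs p q = trans (∑-cong xs split) (∑-+ xs _ _)
      where
      split : ∀ x → ⟦ p x ⟧ ≡ ⟦ p x ∧ q x ⟧ + ⟦ p x ∧ not (q x) ⟧
      split x with p x | q x
      ... | true  | true  = refl
      ... | true  | false = refl
      ... | false | _     = refl

    ∑-⟦⟧-mono : (xs : List A) (p q : A → Bool) → (∀ x → T (p x) → T (q x)) →
      ∑[ x ← xs ] ⟦ p x ⟧ ≤ ∑[ x ← xs ] ⟦ q x ⟧
    ∑-⟦⟧-mono []       p q p⇒q = z≤n
    ∑-⟦⟧-mono (x ∷ xs) p q p⇒q with p x in px | q x in qx
    ... | true  | true  = s≤s (∑-⟦⟧-mono xs p q p⇒q)
    ... | false | true  = m≤n⇒m≤1+n (∑-⟦⟧-mono xs p q p⇒q)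
    ... | false | false = ∑-⟦⟧-mono xs p q p⇒q
    ... | true  | false = ⊥-elim (subst T qx (p⇒q x (subst T (sym px) tt)))

    ∑-⟦⟧-mono-< : (xs : List A) (p q : A → Bool) → (∀ x → T (p x) → T (q x)) →
      ∀ {y} → y ∈ xs → T (q y) → ¬ T (p y) → ∑[ x ← xs ] ⟦ p x ⟧ < ∑[ x ← xs ] ⟦ q x ⟧
    ∑-⟦⟧-mono-< (x ∷ xs) p q p⇒q (here refl) qy ¬py with p x | q x
    ... | false | true  = s≤s (∑-⟦⟧-mono xs p q p⇒q)
    ... | true  | _     = ⊥-elim (¬py tt)
    ∑-⟦⟧-mono-< (x ∷ xs) p q p⇒q (there y∈) qy ¬py with p x in px | q x in qx
    ... | true  | true  = s≤s (∑-⟦⟧-mono-< xs p q p⇒q y∈ qy ¬py)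
    ... | false | true  = m≤n⇒m≤1+n (∑-⟦⟧-mono-< xs p q p⇒q y∈ qy ¬py)
    ... | false | false = ∑-⟦⟧-mono-< xs p q p⇒q y∈ qy ¬py
    ... | true  | false = ⊥-elim (subst T qx (p⇒q x (subst T (sym px) tt)))

    ∑-⟦⟧≤length : (xs : List A) (p : A → Bool) → ∑[ x ← xs ] ⟦ p x ⟧ ≤ length xs
    ∑-⟦⟧≤length []       p = z≤n
    ∑-⟦⟧≤length (x ∷ xs) p with p x
    ... | true  = s≤s (∑-⟦⟧≤length xs p)
    ... | false = m≤n⇒m≤1+n (∑-⟦⟧≤length xs p)

    ∑-⟦⟧-positive : (xs : List A) (p : A → Bool) → ∀ {y} → y ∈ xs → T (p y) → 0 < ∑[ x ← xs ] ⟦ p x ⟧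
    ∑-⟦⟧-positive xs p y∈ py = subst (_< ∑[ x ← xs ] ⟦ p x ⟧) (∑-zero xs)
      (∑-⟦⟧-mono-< xs (λ _ → false) p (λ _ ()) y∈ py (λ ()))

    ∑-mono-≤ : (xs : List A) {f g : A → ℕ} → (∀ x → f x ≤ g x) → ∑ xs f ≤ ∑ xs g
    ∑-mono-≤ []       f≤g = z≤n
    ∑-mono-≤ (x ∷ xs) f≤g = +-mono-≤ (f≤g x) (∑-mono-≤ xs f≤g)

  module _ {a b} {A : Set a} {B : Set b} where

    ∑-comm : (xs : List A) (ys : List B) (f : A → B → ℕ) →
      ∑[ x ← xs ] ∑[ y ← ys ] f x y ≡ ∑[ y ← ys ] ∑[ x ← xs ] f x y
    ∑-comm []       ys f = sym (∑-zero ys)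
    ∑-comm (x ∷ xs) ys f = trans (cong (∑ ys (f x) +_) (∑-comm xs ys f)) (sym (∑-+ ys (f x) _))

    ∑-map : (g : A → B) (xs : List A) (f : B → ℕ) → ∑ (map g xs) f ≡ ∑ xs (f ∘ g)
    ∑-map g []       f = refl
    ∑-map g (x ∷ xs) f = cong (f (g x) +_) (∑-map g xs f)

    ∑-concatMap : (g : A → List B) (xs : List A) (f : B → ℕ) →
      ∑ (concatMap g xs) f ≡ ∑[ x ← xs ] ∑ (g x) f
    ∑-concatMap g []       f = refl
    ∑-concatMap g (x ∷ xs) f = trans (∑-++ (g x) _ f) (cong (∑ (g x) f +_) (∑-concatMap g xs f))

  ∑-allFin-suc : ∀ {n} (f : Fin (suc n) → ℕ) → ∑ (allFin (suc n)) f ≡ f Fin.zero + ∑ (allFin n) (f ∘ Fin.suc)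
  ∑-allFin-suc {n} f = cong (f Fin.zero +_)
    (trans (cong (λ xs → ∑ xs f) (sym (map-tabulate id Fin.suc))) (∑-map Fin.suc (allFin n) f))

  ∑-allFin-⟦⟧≤ : ∀ {n} (p : Fin n → Bool) → ∑[ i ← allFin n ] ⟦ p i ⟧ ≤ n
  ∑-allFin-⟦⟧≤ {n} p = subst (∑[ i ← allFin n ] ⟦ p i ⟧ ≤_) (length-tabulate id) (∑-⟦⟧≤length (allFin n) p)

  ⌊suc≟suc⌋ : ∀ {m} (x a : Fin m) → ⌊ Fin.suc x ≟ᶠ Fin.suc a ⌋ ≡ ⌊ x ≟ᶠ a ⌋
  ⌊suc≟suc⌋ x a with x ≟ᶠ a
  ... | yes refl = refl
  ... | no x≢a with Fin.suc x ≟ᶠ Fin.suc a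
  ...   | yes sx≡sa = ⊥-elim (x≢a (Finₚ.suc-injective sx≡sa))
  ...   | no _      = refl

  ∑-allFin-≟ : ∀ {m} (a : Fin m) → ∑[ x ← allFin m ] ⟦ ⌊ x ≟ᶠ a ⌋ ⟧ ≡ 1
  ∑-allFin-≟ {suc m} Fin.zero = trans (∑-allFin-suc {m} (λ x → ⟦ ⌊ x ≟ᶠ Fin.zero ⌋ ⟧))
    (cong suc (∑-zero (allFin m)))
  ∑-allFin-≟ {suc m} (Fin.suc a) = trans (∑-allFin-suc (λ x → ⟦ ⌊ x ≟ᶠ Fin.suc a ⌋ ⟧))
    (trans (∑-cong (allFin m) (λ x → cong ⟦_⟧ (⌊suc≟suc⌋ x a))) (∑-allFin-≟ a))

  ∑-allFuns-suc : ∀ n m (f : Vec (Fin m) (suc n) → ℕ) →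
    ∑ (allFuns (suc n) m) f ≡ ∑[ v ← allFuns n m ] ∑[ x ← allFin m ] f (x Vec.∷ v)
  ∑-allFuns-suc n m f = trans (∑-concatMap _ (allFuns n m) f) (∑-cong (allFuns n m) (λ v → ∑-map (Vec._∷ v) (allFin m) f))

  length-allFuns : ∀ n m → length (allFuns n m) ≡ m ^ n
  length-allFuns zero    m = refl
  length-allFuns (suc n) m = begin
    length (allFuns (suc n) m)                ≡⟨ sym (trans (∑-const (allFuns (suc n) m) 1) (*-identityʳ _)) ⟩
    ∑[ c ← allFuns (suc n) m ] 1              ≡⟨ ∑-allFuns-suc n m _ ⟩
    ∑[ v ← allFuns n m ] ∑[ x ← allFin m ] 1  ≡⟨ ∑-cong (allFuns n m) (λ _ → trans (∑-const (allFin m) 1) (trans (*-identityʳ _) (length-tabulate id))) ⟩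
    ∑[ v ← allFuns n m ] m                    ≡⟨ ∑-const (allFuns n m) m ⟩
    length (allFuns n m) * m                  ≡⟨ cong (_* m) (length-allFuns n m) ⟩
    m ^ n * m                                 ≡⟨ *-comm (m ^ n) m ⟩
    m ^ suc n                                 ∎
    where open ≡-Reasoning

  ∑< : ℕ → (ℕ → ℕ) → ℕ
  ∑< zero    f = 0
  ∑< (suc L) f = f 0 + ∑< L (f ∘ suc)

  syntax ∑< L (λ k → e) = ∑[ k < L ] e

  ∑<-cong : ∀ L {f g : ℕ → ℕ} → (∀ k → f k ≡ g k) → ∑< L f ≡ ∑< L g
  ∑<-cong zero    h = refl
  ∑<-cong (suc L) h = cong₂ _+_ (h 0) (∑<-cong L (h ∘ suc))

  ∑<-+ : ∀ L (f g : ℕ → ℕ) → ∑[ k < L ] (f k + g k) ≡ ∑< L f + ∑< L g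
  ∑<-+ zero    f g = refl
  ∑<-+ (suc L) f g = trans (cong (f 0 + g 0 +_) (∑<-+ L (f ∘ suc) (g ∘ suc))) (+-interchange (f 0) (g 0) _ _)

  ∑<-zero : ∀ L → ∑[ k < L ] 0 ≡ 0
  ∑<-zero zero    = refl
  ∑<-zero (suc L) = ∑<-zero L

  ∑<-snoc : ∀ L (f : ℕ → ℕ) → ∑< (suc L) f ≡ ∑< L f + f L
  ∑<-snoc zero    f = +-identityʳ (f 0)
  ∑<-snoc (suc L) f = trans (cong (f 0 +_) (∑<-snoc L (f ∘ suc))) (sym (+-assoc (f 0) _ _))

module Closure {n : ℕ} where

  open import Data.Nat using (_+_; _∸_)
  open import Data.Nat.Properties using (≤-trans; m≤n⇒m≤1+n; n≤1+n; m∸n+n≡m; +-comm; <⇒≱)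
  open import Data.Bool.Properties using () renaming (_≟_ to _≟ᵇ_)
  open import Data.Fin.Properties using (all?; ¬∀⟶∃¬)
  open import Data.List.Properties using (map-cong)
  open Booleans
  open Counting

  Reflexive : FlatRel n → Set
  Reflexive R = ∀ i → T (R i i)

  Symmetric : FlatRel n → Set
  Symmetric R = ∀ i j → T (R i j) → T (R j i)

  Transitive : (Fin n → Fin n → Set) → Set
  Transitive W = ∀ i j k → W i j → W j k → W i k

  module _ (R : FlatRel n) where

    R⊆step : R ⊆ᴿ step R
    R⊆step i j = T-∨ .from ∘ inj₁

    step-least : (W : Fin n → Fin n → Set) → (∀ i j → T (R i j) → W i j) → Transitive W →
      ∀ i j → T (step R i j) → W i j
    step-least W R⇒W trans-W i j s with T-∨ .to s
    ... | inj₁ rij = R⇒W i j rij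
    ... | inj₂ two with anyᶠ⁻ _ two
    ...   | l , ril∧rlj = let ril , rlj = T-∧ .to ril∧rlj in trans-W i l j (R⇒W i l ril) (R⇒W l j rlj)

    step-symmetric : Symmetric R → Symmetric (step R)
    step-symmetric sym-R i j s with T-∨ .to s
    ... | inj₁ rij = T-∨ .from (inj₁ (sym-R i j rij))
    ... | inj₂ two with anyᶠ⁻ _ two
    ...   | l , ril∧rlj = let ril , rlj = T-∧ .to ril∧rlj in
                          T-∨ .from (inj₂ (anyᶠ⁺ _ l (T-∧ .from (sym-R l j rlj , sym-R i l ril))))

  R⊆iterStep : ∀ k (R : FlatRel n) → R ⊆ᴿ iterStep k R
  R⊆iterStep zero    R i j r = r
  R⊆iterStep (suc k) R i j r = R⊆iterStep k (step R) i j (R⊆step R i j r)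

  iterStep-least : ∀ k (R : FlatRel n) (W : Fin n → Fin n → Set) → (∀ i j → T (R i j) → W i j) →
    Transitive W → ∀ i j → T (iterStep k R i j) → W i j
  iterStep-least zero    R W R⇒W trans-W = R⇒W
  iterStep-least (suc k) R W R⇒W trans-W = iterStep-least k (step R) W (step-least R W R⇒W trans-W) trans-W

  iterStep-symmetric : ∀ k (R : FlatRel n) → Symmetric R → Symmetric (iterStep k R)
  iterStep-symmetric zero    R sym-R = sym-R
  iterStep-symmetric (suc k) R sym-R = iterStep-symmetric k (step R) (step-symmetric R sym-R)

  reachable : FlatRel n → ℕ → FlatRel n
  reachable R zero    i j = ⌊ i ≟ᶠ j ⌋
  reachable R (suc ℓ) i j = reachable R ℓ i j ∨ anyᶠ (λ l → reachable R ℓ i l ∧ R l j)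

  module _ (R : FlatRel n) where

    reachable-refl : ∀ i → T (reachable R 0 i i)
    reachable-refl i = fromWitness refl

    reachable-suc : ∀ ℓ → reachable R ℓ ⊆ᴿ reachable R (suc ℓ)
    reachable-suc ℓ i j = T-∨ .from ∘ inj₁

    reachable-+ : ∀ d ℓ → reachable R ℓ ⊆ᴿ reachable R (d + ℓ)
    reachable-+ zero    ℓ i j = id
    reachable-+ (suc d) ℓ i j = reachable-suc (d + ℓ) i j ∘ reachable-+ d ℓ i j

    reachable-mono : ∀ {ℓ ℓ′} → ℓ ≤ ℓ′ → reachable R ℓ ⊆ᴿ reachable R ℓ′
    reachable-mono {ℓ} {ℓ′} ℓ≤ℓ′ i j t =
      subst (λ k → T (reachable R k i j)) (m∸n+n≡m ℓ≤ℓ′) (reachable-+ (ℓ′ ∸ ℓ) ℓ i j t)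

    reachable-snoc : ∀ ℓ i l j → T (reachable R ℓ i l) → T (R l j) → T (reachable R (suc ℓ) i j)
    reachable-snoc ℓ i l j p r = T-∨ .from (inj₂ (anyᶠ⁺ _ l (T-∧ .from (p , r))))

    reachable-++ : ∀ a b i j k → T (reachable R a i j) → T (reachable R b j k) → T (reachable R (b + a) i k)
    reachable-++ a zero    i j k p q with toWitness q
    ... | refl = p
    reachable-++ a (suc b) i j k p q with T-∨ .to q
    ... | inj₁ q′ = reachable-suc (b + a) i k (reachable-++ a b i j k p q′)
    ... | inj₂ q′ with anyᶠ⁻ _ q′
    ...   | l , q″ = let q‴ , rlk = T-∧ .to q″ in reachable-snoc (b + a) i l k (reachable-++ a b i j l p q‴) rlk

    Connected : Fin n → Fin n → Set
    Connected i j = ∃[ ℓ ] T (reachable R ℓ i j)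

    Connected-trans : Transitive Connected
    Connected-trans i j k (a , p) (b , q) = b + a , reachable-++ a b i j k p q

    R⊆Connected : ∀ i j → T (R i j) → Connected i j
    R⊆Connected i j r = 1 , reachable-snoc 0 i i j (reachable-refl i) r

  iterStep⊆Connected : ∀ k (R : FlatRel n) i j → T (iterStep k R i j) → Connected R i j
  iterStep⊆Connected k R = iterStep-least k R (Connected R) (R⊆Connected R) (Connected-trans R)

  reachable-monoˡ : ∀ {R S} → R ⊆ᴿ S → ∀ ℓ → reachable R ℓ ⊆ᴿ reachable S ℓ
  reachable-monoˡ R⊆S zero    i j = id
  reachable-monoˡ R⊆S (suc ℓ) i j t with T-∨ .to t
  ... | inj₁ p = T-∨ .from (inj₁ (reachable-monoˡ R⊆S ℓ i j p))
  ... | inj₂ q with anyᶠ⁻ _ q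
  ...   | l , q′ = let p , rlj = T-∧ .to q′ in
                   T-∨ .from (inj₂ (anyᶠ⁺ _ l (T-∧ .from (reachable-monoˡ R⊆S ℓ i l p , R⊆S l j rlj))))

  module _ (R : FlatRel n) (refl-R : Reflexive R) where

    reachable-unsnoc : ∀ ℓ i j → T (reachable R (suc ℓ) i j) → ∃[ l ] (T (reachable R ℓ i l) × T (R l j))
    reachable-unsnoc ℓ i j t with T-∨ .to t
    ... | inj₁ p = j , p , refl-R j
    ... | inj₂ q with anyᶠ⁻ _ q
    ...   | l , q′ = l , T-∧ .to q′

    -- The last two edges of a path merge into one edge of step R.
    reachable-step : ∀ ℓ i j → T (reachable R (suc (suc ℓ)) i j) → T (reachable (step R) (suc ℓ) i j)
    reachable-step ℓ i j t =
      let l , p , rlj = reachable-unsnoc (suc ℓ) i j t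
          l′ , p′ , rl′l = reachable-unsnoc ℓ i l p
      in reachable-snoc (step R) ℓ i l′ j (reachable-monoˡ (R⊆step R) ℓ i l′ p′)
           (T-∨ .from (inj₂ (anyᶠ⁺ _ l (T-∧ .from (rl′l , rlj)))))

  reachable⊆iterStep : ∀ k (R : FlatRel n) → Reflexive R → reachable R (suc k) ⊆ᴿ iterStep k R
  reachable⊆iterStep zero R refl-R i j t with reachable-unsnoc R refl-R 0 i j t
  ... | l , i≡l , rlj with toWitness i≡l
  ...   | refl = rlj
  reachable⊆iterStep (suc k) R refl-R i j t =
    reachable⊆iterStep k (step R) (λ i → R⊆step R i i (refl-R i)) i j (reachable-step R refl-R k i j t)

  -- The sets reachable from i in at most ℓ steps grow strictly until they stabilise; as subsets
  -- of Fin n they must stabilise by ℓ = n, so every path can be shortened to length n.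
  module Shortening (R : FlatRel n) (i : Fin n) where

    reached : ℕ → ℕ
    reached ℓ = ∑[ j ← allFin n ] ⟦ reachable R ℓ i j ⟧

    Stable : ℕ → Set
    Stable ℓ = ∀ j → reachable R (suc ℓ) i j ≡ reachable R ℓ i j

    stable-forever : ∀ {ℓ} → Stable ℓ → ∀ s j → reachable R (s + ℓ) i j ≡ reachable R ℓ i j
    stable-forever st zero    j = refl
    stable-forever {ℓ} st (suc s) j = trans
      (cong₂ _∨_ (stable-forever st s j) (cong BL.or (map-cong (λ l → cong (_∧ R l j) (stable-forever st s l)) (allFin n))))
      (st j)

    newly-reached : ∀ {a b} → a ≢ b → (T b → T a) → T a × ¬ T b
    newly-reached {true}  {false} _   _   = tt , λ ()
    newly-reached {true}  {true}  a≢b _   = ⊥-elim (a≢b refl)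
    newly-reached {false} {false} a≢b _   = ⊥-elim (a≢b refl)
    newly-reached {false} {true}  _   b⇒a = ⊥-elim (b⇒a tt)

    grows-until-stable : ∀ ℓ → ℓ < reached ℓ ⊎ ∃[ ℓ′ ] (ℓ′ ≤ ℓ × Stable ℓ′)
    grows-until-stable zero = inj₁ (∑-⟦⟧-positive (allFin n) _ (∈-allFin i) (reachable-refl R i))
    grows-until-stable (suc ℓ) with grows-until-stable ℓ
    ... | inj₂ (ℓ′ , ℓ′≤ℓ , st) = inj₂ (ℓ′ , m≤n⇒m≤1+n ℓ′≤ℓ , st)
    ... | inj₁ ℓ<reached with all? (λ j → reachable R (suc ℓ) i j ≟ᵇ reachable R ℓ i j)
    ...   | yes st = inj₂ (ℓ , n≤1+n ℓ , st)
    ...   | no ¬st =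
      let j , differs = ¬∀⟶∃¬ n _ (λ j → reachable R (suc ℓ) i j ≟ᵇ reachable R ℓ i j) ¬st
          new , ¬old = newly-reached differs (reachable-suc R ℓ i j)
      in inj₁ (≤-trans (s≤s ℓ<reached)
                 (∑-⟦⟧-mono-< (allFin n) _ _ (reachable-suc R ℓ i) (∈-allFin j) new ¬old))

    stabilises : ∃[ ℓ ] (ℓ ≤ n × Stable ℓ)
    stabilises with grows-until-stable n
    ... | inj₁ n<reached = ⊥-elim (<⇒≱ n<reached (∑-allFin-⟦⟧≤ _))
    ... | inj₂ stable    = stable

    Connected⇒reachable : ∀ j → Connected R i j → T (reachable R n i j)
    Connected⇒reachable j (L , t) =
      let ℓ , ℓ≤n , st = stabilises
      in reachable-mono R ℓ≤n i j
           (subst T (stable-forever st L j)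
             (subst (λ k → T (reachable R k i j)) (+-comm ℓ L) (reachable-+ R ℓ L i j t)))

  iterStep-transitive : (R : FlatRel n) → Reflexive R → Transitive (λ i j → T (iterStep n R i j))
  iterStep-transitive R refl-R i j k p q =
    reachable⊆iterStep n R refl-R i k (reachable-suc R n i k
      (Shortening.Connected⇒reachable R i k
        (Connected-trans R i j k (iterStep⊆Connected n R i j p) (iterStep⊆Connected n R j k q))))

module Flats {n : ℕ} where

  open Booleans
  open Counting
  open Closure
  open IsEquivRel renaming (sym to sym-eq)

  ⊆ᵇ⇒⊆ᴿ : (R S : FlatRel n) → T (R ⊆ᵇ S) → R ⊆ᴿ S
  ⊆ᵇ⇒⊆ᴿ R S t i j = not∨⇒→ (allᶠ⁻ _ (allᶠ⁻ _ t i) j)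

  ⊆ᴿ⇒⊆ᵇ : (R S : FlatRel n) → R ⊆ᴿ S → T (R ⊆ᵇ S)
  ⊆ᴿ⇒⊆ᵇ R S R⊆S = allᶠ⁺ _ (λ i → allᶠ⁺ _ (λ j → →⇒not∨ (R⊆S i j)))

  ¬⊆ᴿ-witness : (R S : FlatRel n) → ¬ (R ⊆ᴿ S) → ∃[ i ] ∃[ j ] (T (R i j) × ¬ T (S i j))
  ¬⊆ᴿ-witness R S R⊈S =
    let i , ¬all = allᶠ-witness _ (R⊈S ∘ ⊆ᵇ⇒⊆ᴿ R S)
        j , ¬imp = allᶠ-witness _ ¬all
    in i , j , ¬not∨⇒ ¬imp

  ≈ᵇ⇒⊆ᴿ : (R S : FlatRel n) → T (R ≈ᵇ S) → R ⊆ᴿ S × S ⊆ᴿ R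
  ≈ᵇ⇒⊆ᴿ R S t = let R⊆S , S⊆R = T-∧ {R ⊆ᵇ S} .to t in ⊆ᵇ⇒⊆ᴿ R S R⊆S , ⊆ᵇ⇒⊆ᴿ S R S⊆R

  ⊆ᴿ⇒≈ᵇ : (R S : FlatRel n) → R ⊆ᴿ S → S ⊆ᴿ R → T (R ≈ᵇ S)
  ⊆ᴿ⇒≈ᵇ R S R⊆S S⊆R = T-∧ {R ⊆ᵇ S} .from (⊆ᴿ⇒⊆ᵇ R S R⊆S , ⊆ᴿ⇒⊆ᵇ S R S⊆R)

  ⊆ᴿ-trans : ∀ {R S U : FlatRel n} → R ⊆ᴿ S → S ⊆ᴿ U → R ⊆ᴿ U
  ⊆ᴿ-trans R⊆S S⊆U i j = S⊆U i j ∘ R⊆S i j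

  ≈ᵇ-isEquivalence : IsEquivalence {A = FlatRel n} (λ R S → T (R ≈ᵇ S))
  ≈ᵇ-isEquivalence = record
    { refl  = λ {R} → ⊆ᴿ⇒≈ᵇ R R (λ _ _ → id) (λ _ _ → id)
    ; sym   = λ {R} {S} t → let R⊆S , S⊆R = ≈ᵇ⇒⊆ᴿ R S t in ⊆ᴿ⇒≈ᵇ S R S⊆R R⊆S
    ; trans = λ {R} {S} {U} t u → let R⊆S , S⊆R = ≈ᵇ⇒⊆ᴿ R S t ; S⊆U , U⊆S = ≈ᵇ⇒⊆ᴿ S U u in
                                  ⊆ᴿ⇒≈ᵇ R U (⊆ᴿ-trans {R} {S} R⊆S S⊆U) (⊆ᴿ-trans {U} {S} U⊆S S⊆R)
    }

  discrete-isEquivRel : IsEquivRel (discrete {n})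
  discrete-isEquivRel = record
    { rfl = λ i → fromWitness refl
    ; sym = λ i j i≡j → fromWitness (sym (toWitness i≡j))
    ; trn = λ i j k i≡j j≡k → fromWitness (trans (toWitness i≡j) (toWitness j≡k))
    }

  discrete⊆ᴿ : (R : FlatRel n) → Reflexive R → discrete ⊆ᴿ R
  discrete⊆ᴿ R refl-R i j i≡j with toWitness i≡j
  ... | refl = refl-R i

  module _ (R S : FlatRel n) where

    private
      R∪S : FlatRel n
      R∪S i j = R i j ∨ S i j

    meetFlat-isEquivRel : IsEquivRel R → IsEquivRel S → IsEquivRel (meetFlat R S)
    meetFlat-isEquivRel eR eS = record
      { rfl = λ i → R⊆iterStep n R∪S i i (refl-∪ i)
      ; sym = iterStep-symmetric n R∪S sym-∪
      ; trn = iterStep-transitive R∪S refl-∪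
      }
      where
      refl-∪ : Reflexive R∪S
      refl-∪ i = T-∨ .from (inj₁ (rfl eR i))
      sym-∪ : Symmetric R∪S
      sym-∪ i j t with T-∨ .to t
      ... | inj₁ r = T-∨ .from (inj₁ (sym-eq eR i j r))
      ... | inj₂ s = T-∨ .from (inj₂ (sym-eq eS i j s))

    ⊆ᴿ-meetFlatˡ : R ⊆ᴿ meetFlat R S
    ⊆ᴿ-meetFlatˡ i j r = R⊆iterStep n R∪S i j (T-∨ .from (inj₁ r))

    ⊆ᴿ-meetFlatʳ : S ⊆ᴿ meetFlat R S
    ⊆ᴿ-meetFlatʳ i j s = R⊆iterStep n R∪S i j (T-∨ .from (inj₂ s))

    meetFlat-least : (W : FlatRel n) → R ⊆ᴿ W → S ⊆ᴿ W → IsEquivRel W → meetFlat R S ⊆ᴿ W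
    meetFlat-least W R⊆W S⊆W eW = iterStep-least n R∪S (λ i j → T (W i j)) R∪S⊆W (trn eW)
      where
      R∪S⊆W : R∪S ⊆ᴿ W
      R∪S⊆W i j t with T-∨ .to t
      ... | inj₁ r = R⊆W i j r
      ... | inj₂ s = S⊆W i j s

  ⋂-isEquivRel : (Rs : List (FlatRel n)) → All IsEquivRel Rs → IsEquivRel (⋂ Rs)
  ⋂-isEquivRel []       []         = discrete-isEquivRel
  ⋂-isEquivRel (R ∷ Rs) (eR ∷ eRs) = meetFlat-isEquivRel R (⋂ Rs) eR (⋂-isEquivRel Rs eRs)

  ∈⇒⊆ᴿ⋂ : (Rs : List (FlatRel n)) → ∀ {R} → R ∈ Rs → R ⊆ᴿ ⋂ Rs
  ∈⇒⊆ᴿ⋂ (R ∷ Rs) (here refl) = ⊆ᴿ-meetFlatˡ R (⋂ Rs)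
  ∈⇒⊆ᴿ⋂ (S ∷ Rs) {R} (there R∈) = ⊆ᴿ-trans {R} {⋂ Rs} (∈⇒⊆ᴿ⋂ Rs R∈) (⊆ᴿ-meetFlatʳ S (⋂ Rs))

  ⋂-least : (Rs : List (FlatRel n)) (W : FlatRel n) → IsEquivRel W → (∀ {R} → R ∈ Rs → R ⊆ᴿ W) → ⋂ Rs ⊆ᴿ W
  ⋂-least []       W eW Rs⊆W = discrete⊆ᴿ W (rfl eW)
  ⋂-least (R ∷ Rs) W eW Rs⊆W = meetFlat-least R (⋂ Rs) W (Rs⊆W (here refl)) (⋂-least Rs W eW (Rs⊆W ∘ there)) eW

module Blocks {n : ℕ} where

  open import Data.Nat using (_<?_)
  open import Data.Nat.Properties using (<ᵇ⇒<; <⇒<ᵇ; <-cmp)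
  open import Data.Fin.Properties using (any?)
  open import Data.Fin.Induction using (<-wellFounded)
  open import Induction.WellFounded using (Acc; acc)
  open import Relation.Binary.Definitions using (tri<; tri≈; tri>)
  open import Relation.Nullary.Decidable using (_×-dec_)
  open Booleans
  open Counting
  open Flats
  open IsEquivRel renaming (sym to sym-eq)

  module _ (R : FlatRel n) where

    isLeader⁻ : ∀ {a} → T (isLeader R a) → ∀ j → toℕ j < toℕ a → ¬ T (R j a)
    isLeader⁻ {a} t j j<a = not∧⇒ (allᶠ⁻ _ t j) (<⇒<ᵇ j<a)

    isLeader⁺ : ∀ a → (∀ j → toℕ j < toℕ a → ¬ T (R j a)) → T (isLeader R a)
    isLeader⁺ a h = allᶠ⁺ _ (λ j → ⇒not∧ (h j ∘ <ᵇ⇒< _ _))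

    blocks≡∑ : blocks R ≡ ∑[ i ← allFin n ] ⟦ isLeader R i ⟧
    blocks≡∑ = length-filterᵇ (isLeader R) (allFin n)

    blocks≤n : blocks R ≤ n
    blocks≤n = subst (_≤ n) (sym blocks≡∑) (∑-allFin-⟦⟧≤ (isLeader R))

    module _ (eR : IsEquivRel R) where

      leader-exists : ∀ i → ∃[ a ] (T (isLeader R a) × T (R a i))
      leader-exists i = go i (<-wellFounded i)
        where
        go : ∀ i → Acc Fin._<_ i → ∃[ a ] (T (isLeader R a) × T (R a i))
        go i (acc smaller) with any? (λ j → toℕ j <? toℕ i ×-dec T? (R j i))
        ... | no ¬earlier = i , isLeader⁺ i (λ j j<i rji → ¬earlier (j , j<i , rji)) , rfl eR i
        ... | yes (j , j<i , rji) = let a , la , raj = go j (smaller j<i) in a , la , trn eR a j i raj rji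

      leader-unique : ∀ {a b} → T (isLeader R a) → T (isLeader R b) → T (R a b) → a ≡ b
      leader-unique {a} {b} la lb rab with <-cmp (toℕ a) (toℕ b)
      ... | tri< a<b _ _ = ⊥-elim (isLeader⁻ lb a a<b rab)
      ... | tri≈ _ a≡b _ = toℕ-injective a≡b
      ... | tri> _ _ b<a = ⊥-elim (isLeader⁻ la b b<a (sym-eq eR a b rab))

      blocks-positive : Fin n → 0 < blocks R
      blocks-positive i =
        let a , la , _ = leader-exists i
        in subst (0 <_) (sym blocks≡∑) (∑-⟦⟧-positive (allFin n) (isLeader R) (∈-allFin a) la)

  isLeader-coarser : (Z Y : FlatRel n) → Z ⊆ᴿ Y → ∀ a → T (isLeader Y a) → T (isLeader Z a)
  isLeader-coarser Z Y Z⊆Y a la = isLeader⁺ Z a (λ j j<a zja → isLeader⁻ Y la j j<a (Z⊆Y j a zja))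

  -- For i ~Y j with i ≁Z j, the Z-leaders of i and j differ but are Y-related, so the larger one
  -- is not a Y-leader.
  strict-coarsening-loses-leader : (Z Y : FlatRel n) → IsEquivRel Z → IsEquivRel Y → Z ⊆ᴿ Y → ¬ (Y ⊆ᴿ Z) →
    ∃[ a ] (T (isLeader Z a) × ¬ T (isLeader Y a))
  strict-coarsening-loses-leader Z Y eZ eY Z⊆Y Y⊈Z =
    let i , j , yij , ¬zij = ¬⊆ᴿ-witness Y Z Y⊈Z
        a , la , zai = leader-exists Z eZ i
        b , lb , zbj = leader-exists Z eZ j
    in distinct-leaders la lb
         (trn eY a i b (Z⊆Y a i zai) (trn eY i j b yij (sym-eq eY b j (Z⊆Y b j zbj))))
         (λ a≡b → ¬zij (trn eZ i a j (sym-eq eZ a i zai) (subst (λ x → T (Z x j)) (sym a≡b) zbj)))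
    where
    distinct-leaders : ∀ {a b} → T (isLeader Z a) → T (isLeader Z b) → T (Y a b) → a ≢ b →
      ∃[ x ] (T (isLeader Z x) × ¬ T (isLeader Y x))
    distinct-leaders {a} {b} la lb yab a≢b with <-cmp (toℕ a) (toℕ b)
    ... | tri< a<b _ _ = b , lb , (λ lyb → isLeader⁻ Y lyb a a<b yab)
    ... | tri≈ _ a≡b _ = ⊥-elim (a≢b (toℕ-injective a≡b))
    ... | tri> _ _ b<a = a , la , (λ lya → isLeader⁻ Y lya b b<a (sym-eq eY a b yab))

  blocks-strict-coarsening : (Z Y : FlatRel n) → IsEquivRel Z → IsEquivRel Y → Z ⊆ᴿ Y → ¬ (Y ⊆ᴿ Z) →
    blocks Y < blocks Z
  blocks-strict-coarsening Z Y eZ eY Z⊆Y Y⊈Z =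
    let a , lza , ¬lya = strict-coarsening-loses-leader Z Y eZ eY Z⊆Y Y⊈Z
    in subst₂ _<_ (sym (blocks≡∑ Y)) (sym (blocks≡∑ Z))
         (∑-⟦⟧-mono-< (allFin n) (isLeader Y) (isLeader Z) (isLeader-coarser Z Y Z⊆Y) (∈-allFin a) lza ¬lya)

module Colourings where

  open import Data.Nat using (_+_; _*_; _^_)
  open import Data.Nat.Properties using (*-identityʳ)
  open import Data.List.Properties using (length-tabulate)
  open import Data.Bool.Properties using (∧-identityʳ)
  open import Data.Fin.Properties using (any?)
  open Booleans
  open Counting
  open Flats
  open Blocks
  open IsEquivRel renaming (sym to sym-eq)

  -- The flat spanned by the cell of c. Note that cellIn R c unfolds to R ⊆ᵇ kernel c; the lemmas
  -- about ⊆ᵇ are applied to cellIn through this.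
  kernel : ∀ {n m} → Vec (Fin m) n → FlatRel n
  kernel c i j = ⌊ lookup c i ≟ᶠ lookup c j ⌋

  kernel-isEquivRel : ∀ {n m} (c : Vec (Fin m) n) → IsEquivRel (kernel c)
  kernel-isEquivRel c = record
    { rfl = λ i → fromWitness refl
    ; sym = λ i j ci≡cj → fromWitness (sym (toWitness ci≡cj))
    ; trn = λ i j k ci≡cj cj≡ck → fromWitness (trans (toWitness ci≡cj) (toWitness cj≡ck))
    }

  restrict : ∀ {n} → FlatRel (suc n) → FlatRel n
  restrict Y i j = Y (Fin.suc i) (Fin.suc j)

  restrict-isEquivRel : ∀ {n} (Y : FlatRel (suc n)) → IsEquivRel Y → IsEquivRel (restrict Y)
  restrict-isEquivRel Y eY = record
    { rfl = λ i → rfl eY (Fin.suc i)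
    ; sym = λ i j → sym-eq eY (Fin.suc i) (Fin.suc j)
    ; trn = λ i j k → trn eY (Fin.suc i) (Fin.suc j) (Fin.suc k)
    }

  module _ {n : ℕ} (Y : FlatRel (suc n)) where

    private
      Y′ = restrict Y

    isLeader-zero : isLeader Y Fin.zero ≡ true
    isLeader-zero = T-ext (λ _ → tt) (λ _ → isLeader⁺ Y Fin.zero (λ _ ()))

    isLeader-suc : ∀ i → isLeader Y (Fin.suc i) ≡ isLeader Y′ i ∧ not (Y Fin.zero (Fin.suc i))
    isLeader-suc i = T-ext forth back
      where
      forth : T (isLeader Y (Fin.suc i)) → T (isLeader Y′ i ∧ not (Y Fin.zero (Fin.suc i)))
      forth l = T-∧ .from ( isLeader⁺ Y′ i (λ j j<i → isLeader⁻ Y l (Fin.suc j) (s≤s j<i))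
                       , ¬T⇒T-not (isLeader⁻ Y l Fin.zero (s≤s z≤n)))
      back : T (isLeader Y′ i ∧ not (Y Fin.zero (Fin.suc i))) → T (isLeader Y (Fin.suc i))
      back t with T-∧ .to t
      ... | l′ , ¬y0i = isLeader⁺ Y (Fin.suc i) earlier
        where
        earlier : ∀ j → toℕ j < suc (toℕ i) → ¬ T (Y j (Fin.suc i))
        earlier Fin.zero    _         = T-not⇒¬T ¬y0i
        earlier (Fin.suc j) (s≤s j<i) = isLeader⁻ Y′ l′ j j<i

    blocks-suc : blocks Y ≡ suc (∑[ i ← allFin n ] ⟦ isLeader Y′ i ∧ not (Y Fin.zero (Fin.suc i)) ⟧)
    blocks-suc = begin
      blocks Y                                                            ≡⟨ blocks≡∑ Y ⟩
      ∑[ i ← allFin (suc n) ] ⟦ isLeader Y i ⟧                            ≡⟨ ∑-allFin-suc (λ i → ⟦ isLeader Y i ⟧) ⟩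
      ⟦ isLeader Y Fin.zero ⟧ + ∑[ i ← allFin n ] ⟦ isLeader Y (Fin.suc i) ⟧
        ≡⟨ cong₂ _+_ (cong ⟦_⟧ isLeader-zero) (∑-cong (allFin n) (cong ⟦_⟧ ∘ isLeader-suc)) ⟩
      suc (∑[ i ← allFin n ] ⟦ isLeader Y′ i ∧ not (Y Fin.zero (Fin.suc i)) ⟧) ∎
      where open ≡-Reasoning

    module _ (eY : IsEquivRel Y) where

      module _ (isolated : ∀ j → ¬ T (Y Fin.zero (Fin.suc j))) where

        blocks-isolated : blocks Y ≡ suc (blocks Y′)
        blocks-isolated = trans blocks-suc (cong suc (trans (∑-cong (allFin n) drop-¬y0) (sym (blocks≡∑ Y′))))
          where
          drop-¬y0 : ∀ i → ⟦ isLeader Y′ i ∧ not (Y Fin.zero (Fin.suc i)) ⟧ ≡ ⟦ isLeader Y′ i ⟧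
          drop-¬y0 i with Y Fin.zero (Fin.suc i) | isolated i
          ... | false | _  = cong ⟦_⟧ (∧-identityʳ _)
          ... | true  | ¬t = ⊥-elim (¬t tt)

        cellIn-cons-isolated : ∀ {m} x (v : Vec (Fin m) n) → cellIn Y (x Vec.∷ v) ≡ cellIn Y′ v
        cellIn-cons-isolated x v = T-ext forth back
          where
          forth : T (cellIn Y (x Vec.∷ v)) → T (cellIn Y′ v)
          forth t = ⊆ᴿ⇒⊆ᵇ Y′ (kernel v) (λ i j → ⊆ᵇ⇒⊆ᴿ Y (kernel (x Vec.∷ v)) t (Fin.suc i) (Fin.suc j))
          back : T (cellIn Y′ v) → T (cellIn Y (x Vec.∷ v))
          back t = ⊆ᴿ⇒⊆ᵇ Y (kernel (x Vec.∷ v)) Y⊆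
            where
            Y⊆ : Y ⊆ᴿ kernel (x Vec.∷ v)
            Y⊆ Fin.zero    Fin.zero    _ = fromWitness refl
            Y⊆ Fin.zero    (Fin.suc j) r = ⊥-elim (isolated j r)
            Y⊆ (Fin.suc i) Fin.zero    r = ⊥-elim (isolated i (sym-eq eY _ _ r))
            Y⊆ (Fin.suc i) (Fin.suc j) r = ⊆ᵇ⇒⊆ᴿ Y′ (kernel v) t i j r

      module _ {j₀ : Fin n} (y0j₀ : T (Y Fin.zero (Fin.suc j₀))) where

        private
          eY′ = restrict-isEquivRel Y eY
          y0≡y0j₀ : ∀ {j} → T (Y Fin.zero (Fin.suc j)) → T (Y′ j₀ j)
          y0≡y0j₀ {j} y0j = trn eY _ Fin.zero _ (sym-eq eY _ _ y0j₀) y0j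

        blocks-joined : blocks Y ≡ blocks Y′
        blocks-joined = begin
          blocks Y                                                                    ≡⟨ blocks-suc ⟩
          suc (∑[ i ← allFin n ] ⟦ isLeader Y′ i ∧ not (y0 i) ⟧)                      ≡⟨ cong (_+ ∑[ i ← allFin n ] ⟦ isLeader Y′ i ∧ not (y0 i) ⟧) (sym (trans (∑-cong (allFin n) (cong ⟦_⟧ ∘ leader-of-j₀)) (∑-allFin-≟ a))) ⟩
          ∑[ i ← allFin n ] ⟦ isLeader Y′ i ∧ y0 i ⟧ + ∑[ i ← allFin n ] ⟦ isLeader Y′ i ∧ not (y0 i) ⟧
                                                                                      ≡⟨ sym (∑-⟦⟧-split (allFin n) (isLeader Y′) y0) ⟩
          ∑[ i ← allFin n ] ⟦ isLeader Y′ i ⟧                                         ≡⟨ sym (blocks≡∑ Y′) ⟩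
          blocks Y′                                                                   ∎
          where
          open ≡-Reasoning
          y0 : Fin n → Bool
          y0 i = Y Fin.zero (Fin.suc i)
          a : Fin n
          a = proj₁ (leader-exists Y′ eY′ j₀)
          leader-of-j₀ : ∀ i → isLeader Y′ i ∧ y0 i ≡ ⌊ i ≟ᶠ a ⌋
          leader-of-j₀ i with leader-exists Y′ eY′ j₀
          ... | a , la , raj₀ = T-ext forth back
            where
            forth : T (isLeader Y′ i ∧ y0 i) → T ⌊ i ≟ᶠ a ⌋
            forth t = let li , y0i = T-∧ .to t in fromWitness (leader-unique Y′ eY′ li la
                        (trn eY′ i j₀ a (sym-eq eY′ j₀ i (y0≡y0j₀ y0i)) (sym-eq eY′ a j₀ raj₀)))
            back : T ⌊ i ≟ᶠ a ⌋ → T (isLeader Y′ i ∧ y0 i)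
            back i≡a with toWitness i≡a
            ... | refl = T-∧ .from (la , trn eY Fin.zero (Fin.suc j₀) (Fin.suc a) y0j₀ (sym-eq eY′ a j₀ raj₀))

        cellIn-cons-joined : ∀ {m} x (v : Vec (Fin m) n) → cellIn Y (x Vec.∷ v) ≡ cellIn Y′ v ∧ ⌊ x ≟ᶠ lookup v j₀ ⌋
        cellIn-cons-joined x v = T-ext forth back
          where
          forth : T (cellIn Y (x Vec.∷ v)) → T (cellIn Y′ v ∧ ⌊ x ≟ᶠ lookup v j₀ ⌋)
          forth t = T-∧ .from
            ( ⊆ᴿ⇒⊆ᵇ Y′ (kernel v) (λ i j → ⊆ᵇ⇒⊆ᴿ Y (kernel (x Vec.∷ v)) t (Fin.suc i) (Fin.suc j))
            , ⊆ᵇ⇒⊆ᴿ Y (kernel (x Vec.∷ v)) t Fin.zero (Fin.suc j₀) y0j₀)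
          back : T (cellIn Y′ v ∧ ⌊ x ≟ᶠ lookup v j₀ ⌋) → T (cellIn Y (x Vec.∷ v))
          back t = ⊆ᴿ⇒⊆ᵇ Y (kernel (x Vec.∷ v)) Y⊆
            where
            Y′⊆ = ⊆ᵇ⇒⊆ᴿ Y′ (kernel v) (proj₁ (T-∧ .to t))
            x≡vj₀ : x ≡ lookup v j₀
            x≡vj₀ = toWitness (proj₂ (T-∧ {cellIn Y′ v} .to t))
            x≡ : ∀ j → T (Y Fin.zero (Fin.suc j)) → x ≡ lookup v j
            x≡ j y0j = trans x≡vj₀ (toWitness (Y′⊆ j₀ j (y0≡y0j₀ y0j)))
            Y⊆ : Y ⊆ᴿ kernel (x Vec.∷ v)
            Y⊆ Fin.zero    Fin.zero    _ = fromWitness refl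
            Y⊆ Fin.zero    (Fin.suc j) r = fromWitness (x≡ j r)
            Y⊆ (Fin.suc i) Fin.zero    r = fromWitness (sym (x≡ i (sym-eq eY _ _ r)))
            Y⊆ (Fin.suc i) (Fin.suc j) r = Y′⊆ i j r

  ∑-allFin-const : ∀ m c → ∑[ x ← allFin m ] c ≡ m * c
  ∑-allFin-const m c = trans (∑-const (allFin m) c) (cong (_* c) (length-tabulate {n = m} id))

  count-respecting : ∀ n m (Y : FlatRel n) → IsEquivRel Y → ∑[ c ← allFuns n m ] ⟦ cellIn Y c ⟧ ≡ m ^ blocks Y
  count-respecting zero    m Y eY = refl
  count-respecting (suc n) m Y eY with any? (λ j → T? (Y Fin.zero (Fin.suc j)))
  ... | no ¬joined = begin
    ∑[ c ← allFuns (suc n) m ] ⟦ cellIn Y c ⟧                    ≡⟨ ∑-allFuns-suc n m _ ⟩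
    ∑[ v ← allFuns n m ] ∑[ x ← allFin m ] ⟦ cellIn Y (x Vec.∷ v) ⟧ ≡⟨ ∑-cong (allFuns n m) extend ⟩
    ∑[ v ← allFuns n m ] (m * ⟦ cellIn Y′ v ⟧)                   ≡⟨ sym (*-distribˡ-∑ m (allFuns n m) _) ⟩
    m * ∑[ v ← allFuns n m ] ⟦ cellIn Y′ v ⟧                     ≡⟨ cong (m *_) (count-respecting n m Y′ (restrict-isEquivRel Y eY)) ⟩
    m * m ^ blocks Y′                                           ≡⟨ cong (m ^_) (sym (blocks-isolated Y eY isolated)) ⟩
    m ^ blocks Y                                                ∎
    where
    open ≡-Reasoning
    Y′ = restrict Y
    isolated : ∀ j → ¬ T (Y Fin.zero (Fin.suc j))
    isolated j y0j = ¬joined (j , y0j)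
    extend : ∀ v → ∑[ x ← allFin m ] ⟦ cellIn Y (x Vec.∷ v) ⟧ ≡ m * ⟦ cellIn Y′ v ⟧
    extend v = trans (∑-cong (allFin m) (λ x → cong ⟦_⟧ (cellIn-cons-isolated Y eY isolated x v)))
                     (∑-allFin-const m _)
  ... | yes (j₀ , y0j₀) = begin
    ∑[ c ← allFuns (suc n) m ] ⟦ cellIn Y c ⟧                    ≡⟨ ∑-allFuns-suc n m _ ⟩
    ∑[ v ← allFuns n m ] ∑[ x ← allFin m ] ⟦ cellIn Y (x Vec.∷ v) ⟧ ≡⟨ ∑-cong (allFuns n m) extend ⟩
    ∑[ v ← allFuns n m ] ⟦ cellIn Y′ v ⟧                         ≡⟨ count-respecting n m Y′ (restrict-isEquivRel Y eY) ⟩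
    m ^ blocks Y′                                               ≡⟨ cong (m ^_) (sym (blocks-joined Y eY y0j₀)) ⟩
    m ^ blocks Y                                                ∎
    where
    open ≡-Reasoning
    Y′ = restrict Y
    extend : ∀ v → ∑[ x ← allFin m ] ⟦ cellIn Y (x Vec.∷ v) ⟧ ≡ ⟦ cellIn Y′ v ⟧
    extend v = begin
      ∑[ x ← allFin m ] ⟦ cellIn Y (x Vec.∷ v) ⟧                   ≡⟨ ∑-cong (allFin m) (λ x → trans (cong ⟦_⟧ (cellIn-cons-joined Y eY y0j₀ x v)) (⟦∧⟧ (cellIn Y′ v) _)) ⟩
      ∑[ x ← allFin m ] (⟦ cellIn Y′ v ⟧ * ⟦ ⌊ x ≟ᶠ lookup v j₀ ⌋ ⟧) ≡⟨ sym (*-distribˡ-∑ ⟦ cellIn Y′ v ⟧ (allFin m) _) ⟩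
      ⟦ cellIn Y′ v ⟧ * ∑[ x ← allFin m ] ⟦ ⌊ x ≟ᶠ lookup v j₀ ⌋ ⟧ ≡⟨ cong (⟦ cellIn Y′ v ⟧ *_) (∑-allFin-≟ (lookup v j₀)) ⟩
      ⟦ cellIn Y′ v ⟧ * 1                                          ≡⟨ *-identityʳ _ ⟩
      ⟦ cellIn Y′ v ⟧                                              ∎

module IntegerSums where

  open import Data.Integer using (+_; _+_; _*_)
  open import Data.Integer.Properties
  open import Algebra.Properties.CommutativeSemigroup +-commutativeSemigroup
    using () renaming (interchange to +-interchange)
  open Counting using (∑)

  ∑ℤ : ∀ {a} {A : Set a} → List A → (A → ℤ) → ℤ
  ∑ℤ xs f = sumℤ (map f xs)

  syntax ∑ℤ xs (λ x → e) = ∑ℤ[ x ← xs ] e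

  module _ {a} {A : Set a} where

    ∑ℤ-cong-∈ : (xs : List A) {f g : A → ℤ} → (∀ {x} → x ∈ xs → f x ≡ g x) → ∑ℤ xs f ≡ ∑ℤ xs g
    ∑ℤ-cong-∈ []       h = refl
    ∑ℤ-cong-∈ (x ∷ xs) h = cong₂ _+_ (h (here refl)) (∑ℤ-cong-∈ xs (h ∘ there))

    ∑ℤ-cong : (xs : List A) {f g : A → ℤ} → (∀ x → f x ≡ g x) → ∑ℤ xs f ≡ ∑ℤ xs g
    ∑ℤ-cong xs h = ∑ℤ-cong-∈ xs (λ {x} _ → h x)

    ∑ℤ-zero : (xs : List A) → ∑ℤ[ x ← xs ] (+ 0) ≡ + 0
    ∑ℤ-zero []       = refl
    ∑ℤ-zero (x ∷ xs) = trans (+-identityˡ _) (∑ℤ-zero xs)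

    ∑ℤ-+ : (xs : List A) (f g : A → ℤ) → ∑ℤ[ x ← xs ] (f x + g x) ≡ ∑ℤ xs f + ∑ℤ xs g
    ∑ℤ-+ []       f g = refl
    ∑ℤ-+ (x ∷ xs) f g = trans (cong (_+_ (f x + g x)) (∑ℤ-+ xs f g)) (+-interchange (f x) (g x) _ _)

    *-distribˡ-∑ℤ : (c : ℤ) (xs : List A) (f : A → ℤ) → c * ∑ℤ xs f ≡ ∑ℤ[ x ← xs ] (c * f x)
    *-distribˡ-∑ℤ c []       f = *-zeroʳ c
    *-distribˡ-∑ℤ c (x ∷ xs) f = trans (*-distribˡ-+ c (f x) _) (cong (_+_ (c * f x)) (*-distribˡ-∑ℤ c xs f))

    pos-∑ : (xs : List A) (f : A → ℕ) → + ∑ xs f ≡ ∑ℤ[ x ← xs ] (+ f x)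
    pos-∑ []       f = refl
    pos-∑ (x ∷ xs) f = trans (pos-+ (f x) _) (cong (_+_ (+ f x)) (pos-∑ xs f))

    ∑ℤ-filterᵇ : (p : A → Bool) (xs : List A) (f : A → ℤ) →
      ∑ℤ (filterᵇ p xs) f ≡ ∑ℤ[ x ← xs ] (if p x then f x else + 0)
    ∑ℤ-filterᵇ p []       f = refl
    ∑ℤ-filterᵇ p (x ∷ xs) f with p x
    ... | true  = cong (_+_ (f x)) (∑ℤ-filterᵇ p xs f)
    ... | false = trans (∑ℤ-filterᵇ p xs f) (sym (+-identityˡ _))

    ∑ℤ-pick : (r : A → A → Bool) → (∀ x → T (r x x)) → (∀ x y → T (r x y) → T (r y x)) →
      (xs : List A) → AllPairs (λ x y → ¬ T (r x y)) xs → ∀ {y} → y ∈ xs → (w : A → ℤ) →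
      ∑ℤ[ x ← xs ] (if r x y then w x else + 0) ≡ w y
    ∑ℤ-pick r r-refl r-sym (x ∷ xs) (x≉xs ∷ _) (here refl) w with r x x | r-refl x
    ... | true | _ = trans (cong (_+_ (w x)) (trans (∑ℤ-cong-∈ xs miss) (∑ℤ-zero xs))) (+-identityʳ (w x))
      where
      miss : ∀ {z} → z ∈ xs → (if r z x then w z else + 0) ≡ + 0
      miss {z} z∈ with r z x in rzx
      ... | true  = ⊥-elim (All.lookup x≉xs z∈ (r-sym z x (subst T (sym rzx) tt)))
      ... | false = refl
    ∑ℤ-pick r r-refl r-sym (x ∷ xs) (x≉xs ∷ xs!) {y} (there y∈) w with r x y in rxy
    ... | true  = ⊥-elim (All.lookup x≉xs y∈ (subst T (sym rxy) tt))
    ... | false = trans (+-identityˡ _) (∑ℤ-pick r r-refl r-sym xs xs! y∈ w)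

  module _ {a b} {A : Set a} {B : Set b} where

    ∑ℤ-comm : (xs : List A) (ys : List B) (f : A → B → ℤ) →
      ∑ℤ[ x ← xs ] ∑ℤ[ y ← ys ] f x y ≡ ∑ℤ[ y ← ys ] ∑ℤ[ x ← xs ] f x y
    ∑ℤ-comm []       ys f = sym (∑ℤ-zero ys)
    ∑ℤ-comm (x ∷ xs) ys f = trans (cong (_+_ (∑ℤ ys (f x))) (∑ℤ-comm xs ys f)) (sym (∑ℤ-+ ys (f x) _))

module Sublists {a} {A : Set a} where

  open import Data.List.Membership.Propositional.Properties using (∈-map⁺; ∈-map⁻; ∈-++⁺ˡ; ∈-++⁺ʳ; ∈-++⁻)

  ∈-sublists⇒⊆ : (xs : List A) → ∀ {s} → s ∈ sublists xs → ∀ {x} → x ∈ s → x ∈ xs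
  ∈-sublists⇒⊆ []       (here refl) ()
  ∈-sublists⇒⊆ (y ∷ xs) s∈ x∈ with ∈-++⁻ (sublists xs) s∈
  ... | inj₁ s∈′ = there (∈-sublists⇒⊆ xs s∈′ x∈)
  ... | inj₂ s∈′ with ∈-map⁻ (y ∷_) s∈′
  ...   | s′ , s′∈ , refl with x∈
  ...     | here x≡y = here x≡y
  ...     | there x∈′ = there (∈-sublists⇒⊆ xs s′∈ x∈′)

  filterᵇ∈sublists : (p : A → Bool) (xs : List A) → filterᵇ p xs ∈ sublists xs
  filterᵇ∈sublists p []       = here refl
  filterᵇ∈sublists p (x ∷ xs) with p x
  ... | true  = ∈-++⁺ʳ (sublists xs) (∈-map⁺ (x ∷_) (filterᵇ∈sublists p xs))
  ... | false = ∈-++⁺ˡ (filterᵇ∈sublists p xs)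

module IntersectionLattice {n : ℕ} (𝒜 : List (FlatRel n)) (flats : All IsEquivRel 𝒜) where

  open import Data.Integer using (+_; _+_; _*_; -_; _-_; _^_)
  open import Data.Integer.Properties
    using (*-identityʳ; *-zeroʳ; +-identityʳ; +-identityˡ; +-inverseˡ; +-inverseʳ; +-assoc; *-distribˡ-+;
           neg-distribʳ-*; pos-+; pos-*; *-commutativeSemigroup)
  open import Algebra.Properties.CommutativeSemigroup *-commutativeSemigroup using (x∙yz≈y∙xz)
  open import Data.Nat as ℕ using (_∸_)
  import Data.Nat.Properties as ℕ
  open import Data.Nat.Properties using (∸-monoʳ-<; ≤-pred; <-≤-trans)
  open import Data.List.Membership.Propositional.Properties using (∈-map⁺; ∈-map⁻; ∈-filter⁺; ∈-filter⁻; ∈-deduplicate⁻)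
  import Data.List.Membership.Setoid.Properties as SetoidMembership
  open import Data.List.Relation.Unary.Any as Any using (Any)
  open import Data.List.Relation.Unary.Unique.DecSetoid.Properties using (deduplicate-!)
  open import Relation.Binary.Bundles using (DecSetoid)
  open Booleans
  open Counting
  open IntegerSums
  open Flats
  open Blocks
  open Sublists
  open Colourings using (kernel; kernel-isEquivRel; count-respecting)
  open IsEquivRel using (rfl)

  ≈ᵇ-decSetoid : DecSetoid _ _
  ≈ᵇ-decSetoid = record
    { Carrier          = FlatRel n
    ; _≈_              = λ R S → T (R ≈ᵇ S)
    ; isDecEquivalence = record { isEquivalence = ≈ᵇ-isEquivalence ; _≟_ = λ R S → T? (R ≈ᵇ S) }
    }

  open DecSetoid ≈ᵇ-decSetoid using () renaming (setoid to ≈ᵇ-setoid; refl to ≈ᵇ-refl; sym to ≈ᵇ-sym; trans to ≈ᵇ-trans)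

  L : List (FlatRel n)
  L = LA 𝒜

  ∈LA⇒⋂ : ∀ {Y} → Y ∈ L → ∃[ sub ] ((∀ {A} → A ∈ sub → A ∈ 𝒜) × Y ≡ ⋂ sub)
  ∈LA⇒⋂ Y∈ = let sub , sub∈ , Y≡⋂sub = ∈-map⁻ ⋂ (∈-deduplicate⁻ _ (map ⋂ (sublists 𝒜)) Y∈)
             in sub , ∈-sublists⇒⊆ 𝒜 sub∈ , Y≡⋂sub

  LA-isEquivRel : ∀ {Y} → Y ∈ L → IsEquivRel Y
  LA-isEquivRel Y∈ with ∈LA⇒⋂ Y∈
  ... | sub , sub⊆𝒜 , refl = ⋂-isEquivRel sub (All.tabulate (All.lookup flats ∘ sub⊆𝒜))

  LA-unique : AllPairs (λ Y Z → ¬ T (Y ≈ᵇ Z)) L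
  LA-unique = deduplicate-! ≈ᵇ-decSetoid (map ⋂ (sublists 𝒜))

  LA-representative : (p : FlatRel n → Bool) → ∃[ Y ] (Y ∈ L × T (Y ≈ᵇ ⋂ (filterᵇ p 𝒜)))
  LA-representative p =
    let J = ⋂ (filterᵇ p 𝒜)
        Y , Y∈ , J≈Y = find (SetoidMembership.∈-deduplicate⁺ ≈ᵇ-setoid (λ R S → T? (R ≈ᵇ S))
                               (λ {R} {U} {S} → ≈ᵇ-respʳ {R} {U} {S})
                               (Any.map (λ { refl → ≈ᵇ-refl {J} }) (∈-map⁺ ⋂ (filterᵇ∈sublists p 𝒜))))
    in Y , Y∈ , ≈ᵇ-sym {J} {Y} J≈Y
    where
    ≈ᵇ-respʳ : ∀ {R U S} → T (S ≈ᵇ U) → T (R ≈ᵇ U) → T (R ≈ᵇ S)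
    ≈ᵇ-respʳ {R} {U} {S} S≈U R≈U = ≈ᵇ-trans {R} {U} {S} R≈U (≈ᵇ-sym {S} {U} S≈U)

  strictlyBelow : FlatRel n → FlatRel n → Bool
  strictlyBelow Y Z = (Z ⊆ᵇ Y) ∧ not (Z ≈ᵇ Y)

  möbius-fuel : ∀ f Y → IsEquivRel Y → n ∸ blocks Y < f → möbius L (suc f) Y ≡ möbius L f Y
  möbius-fuel (suc f) Y eY n∸Y<1+f with Y ≈ᵇ discrete
  ... | true  = refl
  ... | false = cong -_ (∑ℤ-cong-∈ (filterᵇ (strictlyBelow Y) L) fuel-below)
    where
    fuel-below : ∀ {Z} → Z ∈ filterᵇ (strictlyBelow Y) L → möbius L (suc f) Z ≡ möbius L f Z
    fuel-below {Z} Z∈ with ∈-filter⁻ (T? ∘ strictlyBelow Y) Z∈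
    ... | Z∈L , Z<Y =
      let Z⊆Y , Z≉Y = T-∧ .to Z<Y
          eZ = LA-isEquivRel Z∈L
          Y⊈Z = λ Y⊆Z → T-not⇒¬T Z≉Y (⊆ᴿ⇒≈ᵇ Z Y (⊆ᵇ⇒⊆ᴿ Z Y Z⊆Y) Y⊆Z)
          Y<Z = blocks-strict-coarsening Z Y eZ eY (⊆ᵇ⇒⊆ᴿ Z Y Z⊆Y) Y⊈Z
      in möbius-fuel f Z eZ (<-≤-trans (∸-monoʳ-< Y<Z (blocks≤n Z)) (≤-pred n∸Y<1+f))

  module Möbius (0<n : 0 < n) where

    μ : FlatRel n → ℤ
    μ = möbius L (suc n)

    μ-saturated : ∀ {Y} → Y ∈ L → möbius L n Y ≡ μ Y
    μ-saturated {Y} Y∈ = sym (möbius-fuel n Y eY (∸-monoʳ-< (blocks-positive Y eY (Fin.fromℕ< 0<n)) (blocks≤n Y)))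
      where eY = LA-isEquivRel Y∈

    μ-bottom : ∀ Y → T (Y ≈ᵇ discrete) → μ Y ≡ + 1
    μ-bottom Y Y≈⊥ with Y ≈ᵇ discrete
    ... | true = refl

    μ-recursion : ∀ Y → ¬ T (Y ≈ᵇ discrete) → μ Y ≡ - ∑ℤ (filterᵇ (strictlyBelow Y) L) μ
    μ-recursion Y Y≉⊥ with Y ≈ᵇ discrete
    ... | false = cong -_ (∑ℤ-cong-∈ (filterᵇ (strictlyBelow Y) L) (μ-saturated ∘ proj₁ ∘ ∈-filter⁻ (T? ∘ strictlyBelow Y)))
    ... | true  = ⊥-elim (Y≉⊥ tt)

    private
      *-⟦⟧ : ∀ x b → x * + ⟦ b ⟧ ≡ (if b then x else + 0)
      *-⟦⟧ x true  = *-identityʳ x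
      *-⟦⟧ x false = *-zeroʳ x

      *-⟦⟧-split : ∀ x a b → x * + ⟦ a ⟧ ≡ (if a ∧ b then x else + 0) + (if a ∧ not (a ∧ b) then x else + 0)
      *-⟦⟧-split x true  true  = trans (*-identityʳ x) (sym (+-identityʳ x))
      *-⟦⟧-split x true  false = trans (*-identityʳ x) (sym (+-identityˡ x))
      *-⟦⟧-split x false _     = *-zeroʳ x

      pick : ∀ {Y′} → Y′ ∈ L → ∑ℤ[ Y ← L ] (if Y ≈ᵇ Y′ then μ Y else + 0) ≡ μ Y′
      pick Y′∈ = ∑ℤ-pick _≈ᵇ_ (λ Y → ≈ᵇ-refl {Y}) (λ Y Z → ≈ᵇ-sym {Y} {Z}) L LA-unique Y′∈ μ

    μ-sum-below-bottom : ∀ {Y′} → Y′ ∈ L → T (Y′ ≈ᵇ discrete) → ∑ℤ[ Y ← L ] (μ Y * + ⟦ Y ⊆ᵇ Y′ ⟧) ≡ + 1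
    μ-sum-below-bottom {Y′} Y′∈ Y′≈⊥ = begin
      ∑ℤ[ Y ← L ] (μ Y * + ⟦ Y ⊆ᵇ Y′ ⟧)              ≡⟨ ∑ℤ-cong-∈ L (λ {Y} Y∈ → trans (cong (λ b → μ Y * + ⟦ b ⟧) (below⇒equal Y∈)) (*-⟦⟧ (μ Y) _)) ⟩
      ∑ℤ[ Y ← L ] (if Y ≈ᵇ Y′ then μ Y else + 0)      ≡⟨ pick Y′∈ ⟩
      μ Y′                                            ≡⟨ μ-bottom Y′ Y′≈⊥ ⟩
      + 1                                             ∎
      where
      open ≡-Reasoning
      Y′⊆⊥ = proj₁ (≈ᵇ⇒⊆ᴿ Y′ discrete Y′≈⊥)
      below⇒equal : ∀ {Y} → Y ∈ L → (Y ⊆ᵇ Y′) ≡ (Y ≈ᵇ Y′)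
      below⇒equal {Y} Y∈ = T-ext
        (λ Y⊆Y′ → ⊆ᴿ⇒≈ᵇ Y Y′ (⊆ᵇ⇒⊆ᴿ Y Y′ Y⊆Y′) (⊆ᴿ-trans {R = Y′} {S = discrete} Y′⊆⊥ (discrete⊆ᴿ Y (rfl (LA-isEquivRel Y∈)))))
        (proj₁ ∘ T-∧ .to)

    μ-sum-below-other : ∀ {Y′} → Y′ ∈ L → ¬ T (Y′ ≈ᵇ discrete) → ∑ℤ[ Y ← L ] (μ Y * + ⟦ Y ⊆ᵇ Y′ ⟧) ≡ + 0
    μ-sum-below-other {Y′} Y′∈ Y′≉⊥ = begin
      ∑ℤ[ Y ← L ] (μ Y * + ⟦ Y ⊆ᵇ Y′ ⟧)
        ≡⟨ ∑ℤ-cong L (λ Y → *-⟦⟧-split (μ Y) (Y ⊆ᵇ Y′) (Y′ ⊆ᵇ Y)) ⟩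
      ∑ℤ[ Y ← L ] ((if Y ≈ᵇ Y′ then μ Y else + 0) + (if strictlyBelow Y′ Y then μ Y else + 0))
        ≡⟨ ∑ℤ-+ L _ _ ⟩
      ∑ℤ[ Y ← L ] (if Y ≈ᵇ Y′ then μ Y else + 0) + ∑ℤ[ Y ← L ] (if strictlyBelow Y′ Y then μ Y else + 0)
        ≡⟨ cong₂ _+_ (pick Y′∈) (sym (∑ℤ-filterᵇ (strictlyBelow Y′) L μ)) ⟩
      μ Y′ + ∑ℤ (filterᵇ (strictlyBelow Y′) L) μ
        ≡⟨ cong (_+ ∑ℤ (filterᵇ (strictlyBelow Y′) L) μ) (μ-recursion Y′ Y′≉⊥) ⟩
      - ∑ℤ (filterᵇ (strictlyBelow Y′) L) μ + ∑ℤ (filterᵇ (strictlyBelow Y′) L) μ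
        ≡⟨ +-inverseˡ (∑ℤ (filterᵇ (strictlyBelow Y′) L) μ) ⟩
      + 0 ∎
      where open ≡-Reasoning

    μ-sum-below : ∀ {Y′} → Y′ ∈ L → ∑ℤ[ Y ← L ] (μ Y * + ⟦ Y ⊆ᵇ Y′ ⟧) ≡ + ⟦ Y′ ≈ᵇ discrete ⟧
    μ-sum-below {Y′} Y′∈ with Y′ ≈ᵇ discrete in Y′≈⊥
    ... | true  = μ-sum-below-bottom Y′∈ (subst T (sym Y′≈⊥) tt)
    ... | false = μ-sum-below-other Y′∈ (subst T Y′≈⊥)

    module _ (K : FlatRel n) (eK : IsEquivRel K) where

      private
        below = filterᵇ (_⊆ᵇ K) 𝒜
        J     = ⋂ below
        Yₖ    = proj₁ (LA-representative (_⊆ᵇ K))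
        Yₖ∈L  = proj₁ (proj₂ (LA-representative (_⊆ᵇ K)))
        Yₖ≈J  = ≈ᵇ⇒⊆ᴿ Yₖ J (proj₂ (proj₂ (LA-representative (_⊆ᵇ K))))

        ∈below⁻ : ∀ {A} → A ∈ below → A ∈ 𝒜 × A ⊆ᴿ K
        ∈below⁻ A∈ = let A∈𝒜 , A⊆K = ∈-filter⁻ (T? ∘ (_⊆ᵇ K)) A∈ in A∈𝒜 , ⊆ᵇ⇒⊆ᴿ _ K A⊆K

        J-isEquivRel : IsEquivRel J
        J-isEquivRel = ⋂-isEquivRel below (All.tabulate (All.lookup flats ∘ proj₁ ∘ ∈below⁻))

        ⊆K⇔⊆Yₖ : ∀ {Y} → Y ∈ L → (Y ⊆ᵇ K) ≡ (Y ⊆ᵇ Yₖ)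
        ⊆K⇔⊆Yₖ {Y} Y∈ with ∈LA⇒⋂ Y∈
        ... | sub , sub⊆𝒜 , refl = T-ext
          (λ Y⊆K → ⊆ᴿ⇒⊆ᵇ Y Yₖ (⊆ᴿ-trans {R = Y} {S = J}
             (⋂-least sub J J-isEquivRel (λ {A} A∈ → ∈⇒⊆ᴿ⋂ below (∈-filter⁺ (T? ∘ (_⊆ᵇ K)) (sub⊆𝒜 A∈)
                (⊆ᴿ⇒⊆ᵇ A K (⊆ᴿ-trans {R = A} {S = Y} (∈⇒⊆ᴿ⋂ sub A∈) (⊆ᵇ⇒⊆ᴿ Y K Y⊆K))))))
             (proj₂ Yₖ≈J)))
          (λ Y⊆Yₖ → ⊆ᴿ⇒⊆ᵇ Y K (⊆ᴿ-trans {R = Y} {S = Yₖ} (⊆ᵇ⇒⊆ᴿ Y Yₖ Y⊆Yₖ)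
             (⊆ᴿ-trans {R = Yₖ} {S = J} (proj₁ Yₖ≈J) (⋂-least below K eK (proj₂ ∘ ∈below⁻)))))

        Yₖ≈⊥⇔none : All Proper 𝒜 → (Yₖ ≈ᵇ discrete) ≡ not (BL.any (_⊆ᵇ K) 𝒜)
        Yₖ≈⊥⇔none proper = T-ext
          (λ Yₖ≈⊥ → ¬T⇒T-not (λ some →
             let A , A∈𝒜 , A⊆K = find (any⁻ (_⊆ᵇ K) 𝒜 some)
             in All.lookup proper A∈𝒜 (⊆ᴿ-trans {R = A} {S = J}
                  (∈⇒⊆ᴿ⋂ below (∈-filter⁺ (T? ∘ (_⊆ᵇ K)) A∈𝒜 A⊆K))
                  (⊆ᴿ-trans {R = J} {S = Yₖ} (proj₂ Yₖ≈J) (proj₁ (≈ᵇ⇒⊆ᴿ Yₖ discrete Yₖ≈⊥))))))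
          (λ none → ⊆ᴿ⇒≈ᵇ Yₖ discrete
             (⊆ᴿ-trans {R = Yₖ} {S = J} (proj₁ Yₖ≈J)
               (⋂-least below discrete discrete-isEquivRel (λ {A} A∈ →
                  let A∈𝒜 , A⊆K = ∈below⁻ A∈
                  in ⊥-elim (T-not⇒¬T none (any⁺ (_⊆ᵇ K) (lose A∈𝒜 (⊆ᴿ⇒⊆ᵇ A K A⊆K)))))))
             (discrete⊆ᴿ Yₖ (rfl (LA-isEquivRel Yₖ∈L))))

      -- The flats Y ∈ L containing the subspace of K (Y ⊆ᴿ K) are those below Yₖ, the representative
      -- of the intersection of the A ∈ 𝒜 containing it; that interval is trivial iff no such A exists.
      μ-sum-through : All Proper 𝒜 → ∑ℤ[ Y ← L ] (μ Y * + ⟦ Y ⊆ᵇ K ⟧) ≡ + ⟦ not (BL.any (_⊆ᵇ K) 𝒜) ⟧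
      μ-sum-through proper = begin
        ∑ℤ[ Y ← L ] (μ Y * + ⟦ Y ⊆ᵇ K ⟧)   ≡⟨ ∑ℤ-cong-∈ L (λ {Y} Y∈ → cong (λ b → μ Y * + ⟦ b ⟧) (⊆K⇔⊆Yₖ Y∈)) ⟩
        ∑ℤ[ Y ← L ] (μ Y * + ⟦ Y ⊆ᵇ Yₖ ⟧)  ≡⟨ μ-sum-below Yₖ∈L ⟩
        + ⟦ Yₖ ≈ᵇ discrete ⟧               ≡⟨ cong (λ b → + ⟦ b ⟧) (Yₖ≈⊥⇔none proper) ⟩
        + ⟦ not (BL.any (_⊆ᵇ K) 𝒜) ⟧       ∎
        where open ≡-Reasoning

    pos-^ : ∀ m k → (+ m) ^ k ≡ + (m ℕ.^ k)
    pos-^ m zero    = refl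
    pos-^ m (suc k) = trans (cong (_*_ (+ m)) (pos-^ m k)) (sym (pos-* m (m ℕ.^ k)))

    χ-count : All Proper 𝒜 → ∀ m → + m * χ 𝒜 (+ m) ≡ + ∑[ c ← allFuns n m ] ⟦ not (inUnion 𝒜 c) ⟧
    χ-count proper m = begin
      + m * χ 𝒜 (+ m)                                          ≡⟨ *-distribˡ-∑ℤ (+ m) L _ ⟩
      ∑ℤ[ Y ← L ] (+ m * (μ Y * (+ m) ^ dim Y))                   ≡⟨ ∑ℤ-cong-∈ L μ-times-count ⟩
      ∑ℤ[ Y ← L ] (μ Y * ∑ℤ[ c ← Cs ] (+ ⟦ Y ⊆ᵇ kernel c ⟧))   ≡⟨ ∑ℤ-cong L (λ Y → *-distribˡ-∑ℤ (μ Y) Cs _) ⟩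
      ∑ℤ[ Y ← L ] ∑ℤ[ c ← Cs ] (μ Y * + ⟦ Y ⊆ᵇ kernel c ⟧)     ≡⟨ ∑ℤ-comm L Cs _ ⟩
      ∑ℤ[ c ← Cs ] ∑ℤ[ Y ← L ] (μ Y * + ⟦ Y ⊆ᵇ kernel c ⟧)     ≡⟨ ∑ℤ-cong Cs (λ c → μ-sum-through (kernel c) (kernel-isEquivRel c) proper) ⟩
      ∑ℤ[ c ← Cs ] (+ ⟦ not (inUnion 𝒜 c) ⟧)                   ≡⟨ sym (pos-∑ Cs _) ⟩
      + ∑[ c ← Cs ] ⟦ not (inUnion 𝒜 c) ⟧                      ∎
      where
      open ≡-Reasoning
      Cs = allFuns n m
      μ-times-count : ∀ {Y} → Y ∈ L → + m * (μ Y * (+ m) ^ dim Y) ≡ μ Y * ∑ℤ[ c ← Cs ] (+ ⟦ Y ⊆ᵇ kernel c ⟧)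
      μ-times-count {Y} Y∈ = begin
        + m * (μ Y * (+ m) ^ dim Y)                ≡⟨ x∙yz≈y∙xz (+ m) (μ Y) _ ⟩
        μ Y * (+ m) ^ suc (dim Y)                  ≡⟨ cong (λ k → μ Y * (+ m) ^ k) 1+dim≡blocks ⟩
        μ Y * (+ m) ^ blocks Y                     ≡⟨ cong (_*_ (μ Y)) (pos-^ m (blocks Y)) ⟩
        μ Y * + (m ℕ.^ blocks Y)                 ≡⟨ cong (λ k → μ Y * + k) (sym (count-respecting n m Y eY)) ⟩
        μ Y * + ∑[ c ← Cs ] ⟦ cellIn Y c ⟧        ≡⟨ cong (_*_ (μ Y)) (pos-∑ Cs _) ⟩
        μ Y * ∑ℤ[ c ← Cs ] (+ ⟦ Y ⊆ᵇ kernel c ⟧) ∎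
        where
        eY = LA-isEquivRel Y∈
        1+dim≡blocks : suc (dim Y) ≡ blocks Y
        1+dim≡blocks = trans (ℕ.+-comm 1 (dim Y)) (ℕ.m∸n+n≡m (blocks-positive Y eY (Fin.fromℕ< 0<n)))

    tail-count : All Proper 𝒜 → ∀ m → + m * Tail 𝒜 (+ m) ≡ + ∑[ c ← allFuns n m ] ⟦ inUnion 𝒜 c ⟧
    tail-count proper m = begin
      + m * ((+ m) ^ (n ∸ 1) - χ 𝒜 (+ m))                   ≡⟨ *-distribˡ-+ (+ m) _ _ ⟩
      + m * (+ m) ^ (n ∸ 1) + + m * - χ 𝒜 (+ m)             ≡⟨ cong₂ _+_ mⁿ≡all (trans (sym (neg-distribʳ-* (+ m) _)) (cong -_ (χ-count proper m))) ⟩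
      + (inside ℕ.+ outside) - + outside                  ≡⟨ cong (λ k → k - + outside) (pos-+ inside outside) ⟩
      + inside + + outside - + outside                    ≡⟨ +-assoc (+ inside) (+ outside) (- + outside) ⟩
      + inside + (+ outside - + outside)                  ≡⟨ cong (_+_ (+ inside)) (+-inverseʳ (+ outside)) ⟩
      + inside + + 0                                      ≡⟨ +-identityʳ (+ inside) ⟩
      + inside                                            ∎
      where
      open ≡-Reasoning
      Cs = allFuns n m
      inside  = ∑[ c ← Cs ] ⟦ inUnion 𝒜 c ⟧
      outside = ∑[ c ← Cs ] ⟦ not (inUnion 𝒜 c) ⟧
      mⁿ≡all : + m * (+ m) ^ (n ∸ 1) ≡ + (inside ℕ.+ outside)
      mⁿ≡all = begin
        (+ m) ^ suc (n ∸ 1)                 ≡⟨ cong ((+ m) ^_) (trans (ℕ.+-comm 1 (n ∸ 1)) (ℕ.m∸n+n≡m 0<n)) ⟩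
        (+ m) ^ n                           ≡⟨ pos-^ m n ⟩
        + (m ℕ.^ n)                       ≡⟨ cong +_ (sym (length-allFuns n m)) ⟩
        + length Cs                       ≡⟨ cong +_ (sym (trans (∑-const Cs 1) (ℕ.*-identityʳ _))) ⟩
        + ∑[ c ← Cs ] 1                   ≡⟨ cong +_ (∑-⟦⟧-split Cs (λ _ → true) (inUnion 𝒜)) ⟩
        + (inside ℕ.+ outside)            ∎

module ImageCounting where

  open import Data.Nat using (_+_; _*_; _<ᵇ_; _<?_)
  open import Data.Nat.Properties
    using (<ᵇ⇒<; <⇒<ᵇ; ≤-pred; ≤-trans; <-≤-trans; n≤1+n; ≤-antisym; ≮⇒≥; ≤-reflexive; m≤n+m; m≤m+n;
           +-suc; +-identityʳ; *-identityˡ; *-zeroʳ; *-distribʳ-+; +-comm; *-comm; +-commutativeSemigroup)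
  open import Algebra.Properties.CommutativeSemigroup +-commutativeSemigroup using (x∙yz≈xz∙y)
  open import Data.Nat.Combinatorics using (_C_; nCk+nC[k+1]≡[n+1]C[k+1])
  open import Data.Fin.Properties using (punchIn-injective; toℕ<n; toℕ-fromℕ<)
  open import Data.Bool.Properties using (∧-assoc; ∧-comm; ∧-identityʳ)
  open import Data.Vec.Properties using (lookup-map)
  open Booleans
  open Counting

  hits : ∀ {N k} → Fin N → Vec (Fin N) k → Bool
  hits v Vec.[]       = false
  hits v (x Vec.∷ c) = ⌊ x ≟ᶠ v ⌋ ∨ hits v c

  Hits : ∀ {N k} → Vec (Fin N) k → Fin N → Set
  Hits c v = ∃[ i ] lookup c i ≡ v

  module _ {N : ℕ} where

    hits⁺ : ∀ {k} {v : Fin N} (c : Vec (Fin N) k) → Hits c v → T (hits v c)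
    hits⁺ {v = v} (x Vec.∷ c) (Fin.zero , x≡v) = T-∨ .from (inj₁ (fromWitness {a? = x ≟ᶠ v} x≡v))
    hits⁺ {v = v} (x Vec.∷ c) (Fin.suc i , c≡v) = T-∨ {⌊ x ≟ᶠ v ⌋} .from (inj₂ (hits⁺ c (i , c≡v)))

    hits⁻ : ∀ {k} {v : Fin N} (c : Vec (Fin N) k) → T (hits v c) → Hits c v
    hits⁻ (x Vec.∷ c) t with T-∨ .to t
    ... | inj₁ x≡v = Fin.zero , toWitness x≡v
    ... | inj₂ t′  = let i , c≡v = hits⁻ c t′ in Fin.suc i , c≡v

    surj⁺ : ∀ {k} (c : Vec (Fin N) k) → (∀ u → Hits c u) → T (surj c)
    surj⁺ c h = allᶠ⁺ _ (λ u → let i , c≡u = h u in anyᶠ⁺ _ i (fromWitness c≡u))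

    surj⁻ : ∀ {k} (c : Vec (Fin N) k) → T (surj c) → ∀ u → Hits c u
    surj⁻ c t u = let i , c≡u = anyᶠ⁻ _ (allᶠ⁻ _ t u) in i , toWitness c≡u

    covers : ∀ {k} → ℕ → Vec (Fin N) k → Bool
    covers j c = allᶠ λ u → not (toℕ u <ᵇ j) ∨ hits u c

    covers⁺ : ∀ {k} j (c : Vec (Fin N) k) → (∀ u → toℕ u < j → Hits c u) → T (covers j c)
    covers⁺ j c h = allᶠ⁺ _ (λ u → →⇒not∨ (λ u<j → hits⁺ c (h u (<ᵇ⇒< _ _ u<j))))

    covers⁻ : ∀ {k} j (c : Vec (Fin N) k) → T (covers j c) → ∀ u → toℕ u < j → Hits c u
    covers⁻ j c t u u<j = hits⁻ c (not∨⇒→ (allᶠ⁻ _ t u) (<⇒<ᵇ u<j))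

    covers-zero : ∀ {k} (c : Vec (Fin N) k) → covers 0 c ≡ true
    covers-zero c = T-ext (λ _ → tt) (λ _ → covers⁺ 0 c (λ _ ()))

    covers-all : ∀ {k} (c : Vec (Fin N) k) → covers N c ≡ surj c
    covers-all c = T-ext (λ t → surj⁺ c (λ u → covers⁻ N c t u (toℕ<n u)))
                         (λ t → covers⁺ N c (λ u _ → surj⁻ c t u))

    covers-suc : ∀ {k} j (v : Fin N) → toℕ v ≡ j → (c : Vec (Fin N) k) → covers j c ∧ hits v c ≡ covers (suc j) c
    covers-suc j v v≡j c = T-ext forth back
      where
      forth : T (covers j c ∧ hits v c) → T (covers (suc j) c)
      forth t = covers⁺ (suc j) c h
        where
        h : ∀ u → toℕ u < suc j → Hits c u
        h u u<1+j with toℕ u <? j | T-∧ .to t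
        ... | yes u<j | cov , _   = covers⁻ j c cov u u<j
        ... | no u≮j  | _ , hitv with toℕ-injective {i = u} {j = v} (trans (≤-antisym (≤-pred u<1+j) (≮⇒≥ u≮j)) (sym v≡j))
        ...   | refl = hits⁻ c hitv
      back : T (covers (suc j) c) → T (covers j c ∧ hits v c)
      back t = T-∧ .from ( covers⁺ j c (λ u u<j → covers⁻ (suc j) c t u (≤-trans u<j (n≤1+n j)))
                         , hits⁺ c (covers⁻ (suc j) c t v (s≤s (≤-reflexive v≡j))))

  toℕ-punchIn-< : ∀ {N} (v : Fin (suc N)) (u : Fin N) → toℕ u < toℕ v → toℕ (punchIn v u) ≡ toℕ u
  toℕ-punchIn-< (Fin.suc v) Fin.zero    _         = refl
  toℕ-punchIn-< (Fin.suc v) (Fin.suc u) (s≤s u<v) = cong suc (toℕ-punchIn-< v u u<v)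

  covers-punchIn : ∀ {N k} j (v : Fin (suc N)) → toℕ v ≡ j → (c : Vec (Fin N) k) →
    covers j (Vec.map (punchIn v) c) ≡ covers j c
  covers-punchIn {N} j v v≡j c = T-ext forth back
    where
    forth : T (covers j (Vec.map (punchIn v) c)) → T (covers j c)
    forth t = covers⁺ j c h
      where
      h : ∀ u → toℕ u < j → Hits c u
      h u u<j =
        let u<v = subst (toℕ u <_) (sym v≡j) u<j
            i , e = covers⁻ j (Vec.map (punchIn v) c) t (punchIn v u) (subst (_< j) (sym (toℕ-punchIn-< v u u<v)) u<j)
        in i , punchIn-injective v _ _ (trans (sym (lookup-map i (punchIn v) c)) e)
    back : T (covers j c) → T (covers j (Vec.map (punchIn v) c))
    back t = covers⁺ j (Vec.map (punchIn v) c) h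
      where
      h : ∀ u → toℕ u < j → Hits (Vec.map (punchIn v) c) u
      h u u<j =
        let u<v = subst (toℕ u <_) (sym v≡j) u<j
            u′  = Fin.fromℕ< (<-≤-trans u<v (≤-pred (toℕ<n v)))
            toℕu′≡toℕu = toℕ-fromℕ< (<-≤-trans u<v (≤-pred (toℕ<n v)))
            pu′≡u : punchIn v u′ ≡ u
            pu′≡u = toℕ-injective (trans (toℕ-punchIn-< v u′ (subst (_< toℕ v) (sym toℕu′≡toℕu) u<v)) toℕu′≡toℕu)
            i , e = covers⁻ j c t u′ (subst (_< j) (sym toℕu′≡toℕu) u<j)
        in i , trans (lookup-map i (punchIn v) c) (trans (cong (punchIn v) e) pu′≡u)

  ∑-avoiding : ∀ N (v : Fin (suc N)) (g : Fin (suc N) → ℕ) →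
    ∑[ x ← allFin (suc N) ] (⟦ not ⌊ x ≟ᶠ v ⌋ ⟧ * g x) ≡ ∑[ y ← allFin N ] g (punchIn v y)
  ∑-avoiding N Fin.zero g =
    trans (∑-allFin-suc {N} (λ x → ⟦ not ⌊ x ≟ᶠ Fin.zero ⌋ ⟧ * g x)) (∑-cong (allFin N) (λ y → +-identityʳ (g (Fin.suc y))))
  ∑-avoiding (suc N) (Fin.suc v) g = begin
    ∑[ x ← allFin (suc (suc N)) ] (⟦ not ⌊ x ≟ᶠ Fin.suc v ⌋ ⟧ * g x)
      ≡⟨ ∑-allFin-suc {suc N} (λ x → ⟦ not ⌊ x ≟ᶠ Fin.suc v ⌋ ⟧ * g x) ⟩
    g Fin.zero + 0 + ∑[ x ← allFin (suc N) ] (⟦ not ⌊ Fin.suc x ≟ᶠ Fin.suc v ⌋ ⟧ * g (Fin.suc x))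
      ≡⟨ cong₂ _+_ (+-identityʳ (g Fin.zero)) (∑-cong (allFin (suc N)) (λ x → cong (λ b → ⟦ not b ⟧ * g (Fin.suc x)) (⌊suc≟suc⌋ x v))) ⟩
    g Fin.zero + ∑[ x ← allFin (suc N) ] (⟦ not ⌊ x ≟ᶠ v ⌋ ⟧ * g (Fin.suc x))
      ≡⟨ cong (g Fin.zero +_) (∑-avoiding N v (g ∘ Fin.suc)) ⟩
    g Fin.zero + ∑[ y ← allFin N ] g (Fin.suc (punchIn v y))
      ≡⟨ sym (∑-allFin-suc {N} (λ y → g (punchIn (Fin.suc v) y))) ⟩
    ∑[ y ← allFin (suc N) ] g (punchIn (Fin.suc v) y) ∎
    where open ≡-Reasoning

  ∑-avoiding-vec : ∀ k N (v : Fin (suc N)) (φ : Vec (Fin (suc N)) k → ℕ) →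
    ∑[ c ← allFuns k (suc N) ] (⟦ not (hits v c) ⟧ * φ c) ≡ ∑[ c ← allFuns k N ] φ (Vec.map (punchIn v) c)
  ∑-avoiding-vec zero    N v φ = cong (_+ 0) (+-identityʳ (φ Vec.[]))
  ∑-avoiding-vec (suc k) N v φ = begin
    ∑[ c ← allFuns (suc k) (suc N) ] (⟦ not (hits v c) ⟧ * φ c)
      ≡⟨ ∑-allFuns-suc k (suc N) _ ⟩
    ∑[ c ← allFuns k (suc N) ] ∑[ x ← allFin (suc N) ] (⟦ not (⌊ x ≟ᶠ v ⌋ ∨ hits v c) ⟧ * φ (x Vec.∷ c))
      ≡⟨ ∑-cong (allFuns k (suc N)) (λ c → trans (∑-cong (allFin (suc N)) (λ x → ⟦not-∨⟧ ⌊ x ≟ᶠ v ⌋ (hits v c) _))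
                                                 (sym (*-distribˡ-∑ ⟦ not (hits v c) ⟧ (allFin (suc N)) _))) ⟩
    ∑[ c ← allFuns k (suc N) ] (⟦ not (hits v c) ⟧ * ∑[ x ← allFin (suc N) ] (⟦ not ⌊ x ≟ᶠ v ⌋ ⟧ * φ (x Vec.∷ c)))
      ≡⟨ ∑-cong (allFuns k (suc N)) (λ c → cong (⟦ not (hits v c) ⟧ *_) (∑-avoiding N v (λ x → φ (x Vec.∷ c)))) ⟩
    ∑[ c ← allFuns k (suc N) ] (⟦ not (hits v c) ⟧ * ∑[ y ← allFin N ] φ (punchIn v y Vec.∷ c))
      ≡⟨ ∑-avoiding-vec k N v (λ c → ∑[ y ← allFin N ] φ (punchIn v y Vec.∷ c)) ⟩
    ∑[ c ← allFuns k N ] ∑[ y ← allFin N ] φ (punchIn v y Vec.∷ Vec.map (punchIn v) c)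
      ≡⟨ sym (∑-allFuns-suc k N (λ c → φ (Vec.map (punchIn v) c))) ⟩
    ∑[ c ← allFuns (suc k) N ] φ (Vec.map (punchIn v) c) ∎
    where
    open ≡-Reasoning
    ⟦not-∨⟧ : ∀ a b z → ⟦ not (a ∨ b) ⟧ * z ≡ ⟦ not b ⟧ * (⟦ not a ⟧ * z)
    ⟦not-∨⟧ true  b z = sym (*-zeroʳ ⟦ not b ⟧)
    ⟦not-∨⟧ false b z = sym (cong (⟦ not b ⟧ *_) (+-identityʳ z))

  ∑<-0C : ∀ L (a : ℕ → ℕ) → (∀ k → L ≤ k → a k ≡ 0) → ∑[ k < L ] ((0 C k) * a k) ≡ a 0
  ∑<-0C zero    a vanish = sym (vanish 0 z≤n)
  ∑<-0C (suc L) a _      = trans (cong (a 0 + 0 +_) (∑<-zero L)) (trans (+-identityʳ _) (+-identityʳ (a 0)))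

  ∑<-pascal : ∀ L m (a : ℕ → ℕ) → a L ≡ 0 →
    ∑[ k < L ] ((suc m C k) * a k) ≡ ∑[ k < L ] ((m C k) * a k) + ∑[ k < L ] ((m C k) * a (suc k))
  ∑<-pascal zero    m a aL≡0 = refl
  ∑<-pascal (suc L) m a aL≡0 = begin
    1 * a 0 + ∑[ k < L ] ((suc m C suc k) * a (suc k))
      ≡⟨ cong₂ _+_ (*-identityˡ (a 0)) (trans (∑<-cong L (λ k → cong (_* a (suc k)) (sym (nCk+nC[k+1]≡[n+1]C[k+1] m k))))
                                              (trans (∑<-cong L (λ k → *-distribʳ-+ (a (suc k)) (m C k) (m C suc k))) (∑<-+ L _ _))) ⟩
    a 0 + (X + Y)                          ≡⟨ x∙yz≈xz∙y (a 0) X Y ⟩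
    a 0 + Y + X                            ≡⟨ cong₂ _+_ (cong (_+ Y) (sym (*-identityˡ (a 0)))) (sym last-vanishes) ⟩
    1 * a 0 + Y + ∑[ k < suc L ] ((m C k) * a (suc k)) ∎
    where
    open ≡-Reasoning
    X = ∑[ k < L ] ((m C k) * a (suc k))
    Y = ∑[ k < L ] ((m C suc k) * a (suc k))
    last-vanishes : ∑[ k < suc L ] ((m C k) * a (suc k)) ≡ X
    last-vanishes = trans (∑<-snoc L (λ k → (m C k) * a (suc k)))
                          (trans (cong (λ z → X + (m C L) * z) aL≡0) (trans (cong (X +_) (*-zeroʳ (m C L))) (+-identityʳ X)))

  module _ {n : ℕ} (P : ∀ {m} → Vec (Fin m) n → Bool)
           (P-punchIn : ∀ {m} (v : Fin (suc m)) (c : Vec (Fin m) n) → P (Vec.map (punchIn v) c) ≡ P c) where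

    surjections : ℕ → ℕ
    surjections k = length (filterᵇ (λ c → surj c ∧ P c) (allFuns n k))

    covering : ℕ → ℕ → ℕ
    covering N j = ∑[ c ← allFuns n N ] ⟦ P c ∧ covers j c ⟧

    -- Split by whether the colour j is used; the colourings avoiding it are the punchIn-images.
    covering-suc : ∀ N j → j < suc N → covering (suc N) j ≡ covering N j + covering (suc N) (suc j)
    covering-suc N j j<1+N = begin
      covering (suc N) j
        ≡⟨ ∑-⟦⟧-split Cs Q (hits v) ⟩
      ∑[ c ← Cs ] ⟦ Q c ∧ hits v c ⟧ + ∑[ c ← Cs ] ⟦ Q c ∧ not (hits v c) ⟧
        ≡⟨ cong₂ _+_ (∑-cong Cs (λ c → cong ⟦_⟧ (trans (∧-assoc (P c) _ _) (cong (P c ∧_) (covers-suc j v v≡j c)))))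
                     (∑-cong Cs (λ c → trans (⟦∧⟧ (Q c) _) (*-comm ⟦ Q c ⟧ _))) ⟩
      covering (suc N) (suc j) + ∑[ c ← Cs ] (⟦ not (hits v c) ⟧ * ⟦ Q c ⟧)
        ≡⟨ cong (covering (suc N) (suc j) +_) (∑-avoiding-vec n N v (λ c → ⟦ Q c ⟧)) ⟩
      covering (suc N) (suc j) + ∑[ c ← allFuns n N ] ⟦ Q (Vec.map (punchIn v) c) ⟧
        ≡⟨ cong (covering (suc N) (suc j) +_)
             (∑-cong (allFuns n N) (λ c → cong ⟦_⟧ (cong₂ _∧_ (P-punchIn v c) (covers-punchIn j v v≡j c)))) ⟩
      covering (suc N) (suc j) + covering N j
        ≡⟨ +-comm (covering (suc N) (suc j)) (covering N j) ⟩
      covering N j + covering (suc N) (suc j) ∎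
      where
      open ≡-Reasoning
      Cs = allFuns n (suc N)
      v = Fin.fromℕ< j<1+N
      v≡j = toℕ-fromℕ< j<1+N
      Q : Vec (Fin (suc N)) n → Bool
      Q c = P c ∧ covers j c

    covering-diagonal : ∀ j → covering j j ≡ surjections j
    covering-diagonal j =
      trans (∑-cong (allFuns n j) (λ c → cong ⟦_⟧ (trans (cong (P c ∧_) (covers-all c)) (∧-comm (P c) (surj c)))))
            (sym (length-filterᵇ _ (allFuns n j)))

    module _ (L : ℕ) (vanish : ∀ k → L ≤ k → surjections k ≡ 0) where

      covering-binomial : ∀ m j → covering (m + j) j ≡ ∑[ k < L ] ((m C k) * surjections (k + j))
      covering-binomial zero j = trans (covering-diagonal j)
        (sym (∑<-0C L (λ k → surjections (k + j)) (λ k L≤k → vanish (k + j) (≤-trans L≤k (m≤m+n k j)))))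
      covering-binomial (suc m) j = begin
        covering (suc (m + j)) j
          ≡⟨ covering-suc (m + j) j (s≤s (m≤n+m j m)) ⟩
        covering (m + j) j + covering (suc (m + j)) (suc j)
          ≡⟨ cong (λ N → covering (m + j) j + covering N (suc j)) (sym (+-suc m j)) ⟩
        covering (m + j) j + covering (m + suc j) (suc j)
          ≡⟨ cong₂ _+_ (covering-binomial m j) (covering-binomial m (suc j)) ⟩
        ∑[ k < L ] ((m C k) * s (k + j)) + ∑[ k < L ] ((m C k) * s (k + suc j))
          ≡⟨ cong (∑[ k < L ] ((m C k) * s (k + j)) +_) (∑<-cong L (λ k → cong (λ z → (m C k) * s z) (+-suc k j))) ⟩
        ∑[ k < L ] ((m C k) * s (k + j)) + ∑[ k < L ] ((m C k) * s (suc k + j))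
          ≡⟨ sym (∑<-pascal L m (λ k → s (k + j)) (vanish (L + j) (m≤m+n L j))) ⟩
        ∑[ k < L ] ((suc m C k) * s (k + j)) ∎
        where
        open ≡-Reasoning
        s = surjections

      count-by-image : ∀ m → ∑[ c ← allFuns n m ] ⟦ P c ⟧ ≡ ∑[ k < L ] ((m C k) * surjections k)
      count-by-image m = begin
        ∑[ c ← allFuns n m ] ⟦ P c ⟧                        ≡⟨ ∑-cong (allFuns n m) (λ c → cong ⟦_⟧ (sym (trans (cong (P c ∧_) (covers-zero c)) (∧-identityʳ (P c))))) ⟩
        covering m 0                                         ≡⟨ cong (λ N → covering N 0) (sym (+-identityʳ m)) ⟩
        covering (m + 0) 0                                   ≡⟨ covering-binomial m 0 ⟩
        ∑[ k < L ] ((m C k) * surjections (k + 0))           ≡⟨ ∑<-cong L (λ k → cong (λ z → (m C k) * surjections z) (+-identityʳ k)) ⟩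
        ∑[ k < L ] ((m C k) * surjections k)                 ∎
        where open ≡-Reasoning

module CellCounts where

  open import Data.Nat using (_*_; _^_)
  open import Data.Nat.Properties using (*-identityʳ; ≤-trans; ≤-refl; m≤m⊔n; m≤n⊔m; <⇒≱; ^-zeroˡ; module ≤-Reasoning)
  open import Data.List.Properties using (map-cong)
  open import Data.Bool.Properties using (∧-zeroʳ)
  open import Data.Vec.Properties using (lookup-map)
  open Booleans
  open Counting
  open Flats
  open Blocks
  open Colourings
  open ImageCounting using (surj⁺; surj⁻)

  cellIn-map-injective : ∀ {n M N} (R : FlatRel n) {g : Fin M → Fin N} → (∀ {x y} → g x ≡ g y → x ≡ y) →
    (c : Vec (Fin M) n) → cellIn R (Vec.map g c) ≡ cellIn R c
  cellIn-map-injective R {g} g-inj c = T-ext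
    (λ t → ⊆ᴿ⇒⊆ᵇ R (kernel c) (λ i j r → fromWitness (g-inj
      (trans (sym (lookup-map i g c)) (trans (toWitness (⊆ᵇ⇒⊆ᴿ R (kernel (Vec.map g c)) t i j r)) (lookup-map j g c))))))
    (λ t → ⊆ᴿ⇒⊆ᵇ R (kernel (Vec.map g c)) (λ i j r → fromWitness
      (trans (lookup-map i g c) (trans (cong g (toWitness (⊆ᵇ⇒⊆ᴿ R (kernel c) t i j r))) (sym (lookup-map j g c))))))

  inUnion-map-injective : ∀ {n M N} (𝒜 : List (FlatRel n)) {g : Fin M → Fin N} → (∀ {x y} → g x ≡ g y → x ≡ y) →
    (c : Vec (Fin M) n) → inUnion 𝒜 (Vec.map g c) ≡ inUnion 𝒜 c
  inUnion-map-injective 𝒜 g-inj c = cong BL.or (map-cong (λ R → cellIn-map-injective R g-inj c) 𝒜)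

  -- Every colour u is taken at some leader (the leader of any preimage of u), and a leader has a
  -- single colour: so there are at least as many leaders as colours.
  surj-cellIn⇒≤blocks : ∀ {n k} (R : FlatRel n) → IsEquivRel R → (c : Vec (Fin k) n) → T (surj c) → T (cellIn R c) →
    k ≤ blocks R
  surj-cellIn⇒≤blocks {n} {k} R eR c onto respects = begin
    k                                                                           ≡⟨ sym (trans (∑-allFin-const k 1) (*-identityʳ k)) ⟩
    ∑[ u ← allFin k ] 1                                                         ≤⟨ ∑-mono-≤ (allFin k) coloured-leader ⟩
    ∑[ u ← allFin k ] ∑[ a ← allFin n ] ⟦ isLeader R a ∧ ⌊ u ≟ᶠ lookup c a ⌋ ⟧  ≡⟨ ∑-comm (allFin k) (allFin n) _ ⟩
    ∑[ a ← allFin n ] ∑[ u ← allFin k ] ⟦ isLeader R a ∧ ⌊ u ≟ᶠ lookup c a ⌋ ⟧  ≡⟨ ∑-cong (allFin n) one-colour ⟩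
    ∑[ a ← allFin n ] ⟦ isLeader R a ⟧                                          ≡⟨ sym (blocks≡∑ R) ⟩
    blocks R                                                                    ∎
    where
    open ≤-Reasoning
    coloured-leader : ∀ u → 1 ≤ ∑[ a ← allFin n ] ⟦ isLeader R a ∧ ⌊ u ≟ᶠ lookup c a ⌋ ⟧
    coloured-leader u =
      let i , cᵢ≡u = surj⁻ c onto u
          a , la , rai = leader-exists R eR i
          cₐ≡cᵢ = toWitness (⊆ᵇ⇒⊆ᴿ R (kernel c) respects a i rai)
      in ∑-⟦⟧-positive (allFin n) _ (∈-allFin a) (T-∧ .from (la , fromWitness (sym (trans cₐ≡cᵢ cᵢ≡u))))
    one-colour : ∀ a → ∑[ u ← allFin k ] ⟦ isLeader R a ∧ ⌊ u ≟ᶠ lookup c a ⌋ ⟧ ≡ ⟦ isLeader R a ⟧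
    one-colour a = begin-equality
      ∑[ u ← allFin k ] ⟦ isLeader R a ∧ ⌊ u ≟ᶠ lookup c a ⌋ ⟧    ≡⟨ ∑-cong (allFin k) (λ u → ⟦∧⟧ (isLeader R a) _) ⟩
      ∑[ u ← allFin k ] (⟦ isLeader R a ⟧ * ⟦ ⌊ u ≟ᶠ lookup c a ⌋ ⟧) ≡⟨ sym (*-distribˡ-∑ ⟦ isLeader R a ⟧ (allFin k) _) ⟩
      ⟦ isLeader R a ⟧ * ∑[ u ← allFin k ] ⟦ ⌊ u ≟ᶠ lookup c a ⌋ ⟧  ≡⟨ cong (⟦ isLeader R a ⟧ *_) (∑-allFin-≟ (lookup c a)) ⟩
      ⟦ isLeader R a ⟧ * 1                                         ≡⟨ *-identityʳ _ ⟩
      ⟦ isLeader R a ⟧                                             ∎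

  dim≤dA : ∀ {n} (𝒜 : List (FlatRel n)) {R} → R ∈ 𝒜 → dim R ≤ dA 𝒜
  dim≤dA (A ∷ 𝒜) (here refl) = m≤m⊔n (dim A) (dA 𝒜)
  dim≤dA (A ∷ 𝒜) (there R∈)  = ≤-trans (dim≤dA 𝒜 R∈) (m≤n⊔m (dim A) (dA 𝒜))

  blocks≤1+dim : ∀ {n} (R : FlatRel n) → blocks R ≤ suc (dim R)
  blocks≤1+dim R with blocks R
  ... | zero  = z≤n
  ... | suc b = ≤-refl

  cellCount-vanishes : ∀ {n} (𝒜 : List (FlatRel n)) → All IsEquivRel 𝒜 → ∀ k → suc (suc (dA 𝒜)) ≤ k → cellCount 𝒜 k ≡ 0
  cellCount-vanishes {n} 𝒜 flats k 2+d≤k =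
    trans (length-filterᵇ _ (allFuns n k)) (trans (∑-cong (allFuns n k) no-cell) (∑-zero (allFuns n k)))
    where
    no-cell : ∀ c → ⟦ surj c ∧ inUnion 𝒜 c ⟧ ≡ 0
    no-cell c with surj c ∧ inUnion 𝒜 c in cell
    ... | false = refl
    ... | true  =
      let onto , inside = T-∧ .to (subst T (sym cell) tt)
          R , R∈ , cR = find (any⁻ _ 𝒜 inside)
      in ⊥-elim (<⇒≱ 2+d≤k (≤-trans (surj-cellIn⇒≤blocks R (All.lookup flats R∈) c onto cR)
                                    (≤-trans (blocks≤1+dim R) (s≤s (dim≤dA 𝒜 R∈)))))

  cellCount-[] : ∀ {n} k → cellCount {n} [] k ≡ 0
  cellCount-[] {n} k = trans (length-filterᵇ _ (allFuns n k))
    (trans (∑-cong (allFuns n k) (λ c → cong ⟦_⟧ (∧-zeroʳ (surj c)))) (∑-zero (allFuns n k)))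

  cellCount-zero : ∀ {n} (𝒜 : List (FlatRel (suc n))) → cellCount 𝒜 0 ≡ 0
  cellCount-zero {n} 𝒜 = trans (length-filterᵇ _ (allFuns (suc n) 0)) (trans (∑-allFuns-suc n 0 _) (∑-zero (allFuns n 0)))

  cellCount-one : ∀ {n} (A : FlatRel (suc n)) (𝒜 : List (FlatRel (suc n))) → cellCount (A ∷ 𝒜) 1 ≡ 1
  cellCount-one {n} A 𝒜 = begin
    cellCount (A ∷ 𝒜) 1                                    ≡⟨ length-filterᵇ _ (allFuns (suc n) 1) ⟩
    ∑[ c ← allFuns (suc n) 1 ] ⟦ surj c ∧ inUnion (A ∷ 𝒜) c ⟧ ≡⟨ ∑-cong (allFuns (suc n) 1) (λ c → cong ⟦_⟧ (T-ext (λ _ → tt) (λ _ → constant-cell c))) ⟩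
    ∑[ c ← allFuns (suc n) 1 ] 1                             ≡⟨ trans (∑-const (allFuns (suc n) 1) 1) (*-identityʳ _) ⟩
    length (allFuns (suc n) 1)                              ≡⟨ length-allFuns (suc n) 1 ⟩
    1 ^ suc n                                               ≡⟨ ^-zeroˡ (suc n) ⟩
    1                                                 ∎
    where
    open ≡-Reasoning
    only : (x y : Fin 1) → x ≡ y
    only Fin.zero Fin.zero = refl
    constant-cell : (c : Vec (Fin 1) (suc n)) → T (surj c ∧ inUnion (A ∷ 𝒜) c)
    constant-cell c = T-∧ .from ( surj⁺ c (λ u → Fin.zero , only _ _)
                                , T-∨ .from (inj₁ (⊆ᴿ⇒⊆ᵇ A (kernel c) (λ i j _ → fromWitness (only _ _)))))

module PowerSeries where

  open import Data.Integer using (+_; -_; _+_; _*_)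
  open import Data.Integer.Properties
  open import Data.Integer.Tactic.RingSolver using (solve-∀)
  open import Data.Nat as ℕ using (_∸_)
  import Data.Nat.Properties as ℕ
  open import Data.Nat.Combinatorics using (_C_; nCk+nC[k+1]≡[n+1]C[k+1])
  open import Data.List using (applyUpTo)
  open import Relation.Binary.PropositionalEquality using (_≗_)
  open import Algebra.Properties.CommutativeSemigroup +-commutativeSemigroup
    using () renaming (interchange to +-interchange)
  open import Algebra.Properties.CommutativeSemigroup *-commutativeSemigroup using (x∙yz≈y∙xz)

  Series : Set
  Series = ℕ → ℤ

  shift : Series → Series
  shift s zero    = + 0
  shift s (suc m) = s m

  infixr 7 _*ₛ_

  _*ₛ_ : Poly → Series → Series
  ([]      *ₛ s) m = + 0
  ((a ∷ p) *ₛ s) m = a * s m + (p *ₛ shift s) m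

  shift-cong : ∀ {s t} → s ≗ t → shift s ≗ shift t
  shift-cong s≗t zero    = refl
  shift-cong s≗t (suc m) = s≗t m

  *ₛ-cong : ∀ p {s t} → s ≗ t → p *ₛ s ≗ p *ₛ t
  *ₛ-cong []      s≗t m = refl
  *ₛ-cong (a ∷ p) s≗t m = cong₂ _+_ (cong (a *_) (s≗t m)) (*ₛ-cong p (shift-cong s≗t) m)

  *ₛ-zeroʳ : ∀ p → p *ₛ (λ _ → + 0) ≗ (λ _ → + 0)
  *ₛ-zeroʳ []      m = refl
  *ₛ-zeroʳ (a ∷ p) m = cong₂ _+_ (*-zeroʳ a) (trans (*ₛ-cong p shift-zero m) (*ₛ-zeroʳ p m))
    where
    shift-zero : shift (λ _ → + 0) ≗ (λ _ → + 0)
    shift-zero zero    = refl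
    shift-zero (suc m) = refl

  *ₛ-shift : ∀ p s → p *ₛ shift s ≗ shift (p *ₛ s)
  *ₛ-shift []      s zero    = refl
  *ₛ-shift []      s (suc m) = refl
  *ₛ-shift (a ∷ p) s zero    = cong₂ _+_ (*-zeroʳ a) (*ₛ-shift p (shift s) zero)
  *ₛ-shift (a ∷ p) s (suc m) = cong (_+_ (a * s m)) (*ₛ-shift p (shift s) (suc m))

  *ₛ-identityˡ : ∀ s → (+ 1 ∷ []) *ₛ s ≗ s
  *ₛ-identityˡ s m = trans (+-identityʳ _) (*-identityˡ (s m))

  *ₛ-distribʳ-+ₚ : ∀ p q s → (p +ₚ q) *ₛ s ≗ (λ m → (p *ₛ s) m + (q *ₛ s) m)
  *ₛ-distribʳ-+ₚ []      q       s m = sym (+-identityˡ _)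
  *ₛ-distribʳ-+ₚ (a ∷ p) []      s m = sym (+-identityʳ _)
  *ₛ-distribʳ-+ₚ (a ∷ p) (b ∷ q) s m =
    trans (cong₂ _+_ (*-distribʳ-+ (s m) a b) (*ₛ-distribʳ-+ₚ p q (shift s) m))
          (+-interchange (a * s m) (b * s m) ((p *ₛ shift s) m) ((q *ₛ shift s) m))

  *ₛ-scaleˡ : ∀ c p s → map (c *_) p *ₛ s ≗ (λ m → c * (p *ₛ s) m)
  *ₛ-scaleˡ c []      s m = sym (*-zeroʳ c)
  *ₛ-scaleˡ c (a ∷ p) s m = trans (cong₂ _+_ (*-assoc c a (s m)) (*ₛ-scaleˡ c p (shift s) m)) (sym (*-distribˡ-+ c _ _))

  *ₛ-distribˡ-+ : ∀ p s t → p *ₛ (λ k → s k + t k) ≗ (λ m → (p *ₛ s) m + (p *ₛ t) m)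
  *ₛ-distribˡ-+ []      s t m = refl
  *ₛ-distribˡ-+ (a ∷ p) s t m =
    trans (cong₂ _+_ (*-distribˡ-+ a (s m) (t m)) (trans (*ₛ-cong p shift-+ m) (*ₛ-distribˡ-+ p (shift s) (shift t) m)))
          (+-interchange (a * s m) (a * t m) ((p *ₛ shift s) m) ((p *ₛ shift t) m))
    where
    shift-+ : shift (λ k → s k + t k) ≗ (λ k → shift s k + shift t k)
    shift-+ zero    = refl
    shift-+ (suc m) = refl

  *ₛ-scaleʳ : ∀ p c s → p *ₛ (λ k → c * s k) ≗ (λ m → c * (p *ₛ s) m)
  *ₛ-scaleʳ []      c s m = sym (*-zeroʳ c)
  *ₛ-scaleʳ (a ∷ p) c s m =
    trans (cong₂ _+_ (x∙yz≈y∙xz a c (s m)) (trans (*ₛ-cong p shift-scale m) (*ₛ-scaleʳ p c (shift s) m)))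
          (sym (*-distribˡ-+ c _ _))
    where
    shift-scale : shift (λ k → c * s k) ≗ (λ k → c * shift s k)
    shift-scale zero    = sym (*-zeroʳ c)
    shift-scale (suc m) = refl

  *ₚ-*ₛ : ∀ p q s → (p *ₚ q) *ₛ s ≗ p *ₛ (q *ₛ s)
  *ₚ-*ₛ []      q s m = refl
  *ₚ-*ₛ (a ∷ p) q s m = begin
    ((map (a *_) q +ₚ (+ 0 ∷ (p *ₚ q))) *ₛ s) m          ≡⟨ *ₛ-distribʳ-+ₚ (map (a *_) q) (+ 0 ∷ (p *ₚ q)) s m ⟩
    (map (a *_) q *ₛ s) m + (+ 0 * s m + ((p *ₚ q) *ₛ shift s) m)
                                                         ≡⟨ cong₂ _+_ (*ₛ-scaleˡ a q s m) (+-identityˡ _) ⟩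
    a * (q *ₛ s) m + ((p *ₚ q) *ₛ shift s) m             ≡⟨ cong (_+_ (a * (q *ₛ s) m)) (trans (*ₚ-*ₛ p q (shift s) m) (*ₛ-cong p (*ₛ-shift q s) m)) ⟩
    a * (q *ₛ s) m + (p *ₛ shift (q *ₛ s)) m             ∎
    where open ≡-Reasoning

  *ₛ-comm : ∀ p q s → p *ₛ (q *ₛ s) ≗ q *ₛ (p *ₛ s)
  *ₛ-comm []      q s m = sym (*ₛ-zeroʳ q m)
  *ₛ-comm (a ∷ p) q s m = begin
    a * (q *ₛ s) m + (p *ₛ shift (q *ₛ s)) m        ≡⟨ cong (_+_ (a * (q *ₛ s) m)) (trans (*ₛ-cong p (sym ∘ *ₛ-shift q s) m) (*ₛ-comm p q (shift s) m)) ⟩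
    a * (q *ₛ s) m + (q *ₛ (p *ₛ shift s)) m        ≡⟨ cong (_+ (q *ₛ (p *ₛ shift s)) m) (sym (*ₛ-scaleʳ q a s m)) ⟩
    (q *ₛ (λ k → a * s k)) m + (q *ₛ (p *ₛ shift s)) m ≡⟨ sym (*ₛ-distribˡ-+ q (λ k → a * s k) (p *ₛ shift s) m) ⟩
    (q *ₛ ((a ∷ p) *ₛ s)) m                         ∎
    where open ≡-Reasoning

  ^ₚ-*ₛ : ∀ p a b s → (p ^ₚ (a ℕ.+ b)) *ₛ s ≗ (p ^ₚ a) *ₛ ((p ^ₚ b) *ₛ s)
  ^ₚ-*ₛ p zero    b s m = sym (*ₛ-identityˡ ((p ^ₚ b) *ₛ s) m)
  ^ₚ-*ₛ p (suc a) b s m = begin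
    ((p *ₚ (p ^ₚ (a ℕ.+ b))) *ₛ s) m       ≡⟨ *ₚ-*ₛ p (p ^ₚ (a ℕ.+ b)) s m ⟩
    (p *ₛ ((p ^ₚ (a ℕ.+ b)) *ₛ s)) m       ≡⟨ *ₛ-cong p (^ₚ-*ₛ p a b s) m ⟩
    (p *ₛ ((p ^ₚ a) *ₛ ((p ^ₚ b) *ₛ s))) m ≡⟨ sym (*ₚ-*ₛ p (p ^ₚ a) ((p ^ₚ b) *ₛ s) m) ⟩
    ((p *ₚ (p ^ₚ a)) *ₛ ((p ^ₚ b) *ₛ s)) m ∎
    where open ≡-Reasoning

  coeff-0∷ : ∀ p → coeff (+ 0 ∷ p) ≗ shift (coeff p)
  coeff-0∷ p zero    = refl
  coeff-0∷ p (suc m) = refl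

  coeff-+ₚ : ∀ p q → coeff (p +ₚ q) ≗ (λ m → coeff p m + coeff q m)
  coeff-+ₚ []      q       m       = sym (+-identityˡ _)
  coeff-+ₚ (a ∷ p) []      m       = sym (+-identityʳ _)
  coeff-+ₚ (a ∷ p) (b ∷ q) zero    = refl
  coeff-+ₚ (a ∷ p) (b ∷ q) (suc m) = coeff-+ₚ p q m

  coeff-scale : ∀ c p → coeff (map (c *_) p) ≗ (λ m → c * coeff p m)
  coeff-scale c []      m       = sym (*-zeroʳ c)
  coeff-scale c (a ∷ p) zero    = refl
  coeff-scale c (a ∷ p) (suc m) = coeff-scale c p m

  coeff-*ₚ : ∀ p q → coeff (p *ₚ q) ≗ p *ₛ coeff q
  coeff-*ₚ []      q m = refl
  coeff-*ₚ (a ∷ p) q m = begin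
    coeff (map (a *_) q +ₚ (+ 0 ∷ (p *ₚ q))) m        ≡⟨ coeff-+ₚ (map (a *_) q) _ m ⟩
    coeff (map (a *_) q) m + coeff (+ 0 ∷ (p *ₚ q)) m ≡⟨ cong₂ _+_ (coeff-scale a q m) (coeff-0∷ (p *ₚ q) m) ⟩
    a * coeff q m + shift (coeff (p *ₚ q)) m          ≡⟨ cong (_+_ (a * coeff q m)) (trans (shift-cong (coeff-*ₚ p q) m) (sym (*ₛ-shift p (coeff q) m))) ⟩
    a * coeff q m + (p *ₛ shift (coeff q)) m          ∎
    where open ≡-Reasoning

  coeff-sumPoly : ∀ ps m → coeff (sumPoly ps) m ≡ sumℤ (map (λ q → coeff q m) ps)
  coeff-sumPoly []       m = refl
  coeff-sumPoly (q ∷ ps) m = trans (coeff-+ₚ q (sumPoly ps) m) (cong (_+_ (coeff q m)) (coeff-sumPoly ps m))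

  coeff-x* : ∀ p → coeff (Xpow 1 *ₚ p) ≗ shift (coeff p)
  coeff-x* p m = trans (coeff-*ₚ (Xpow 1) p m)
    (trans (cong₂ _+_ (*-zeroˡ (coeff p m)) (trans (+-identityʳ (+ 1 * shift (coeff p) m)) (*-identityˡ (shift (coeff p) m))))
           (+-identityˡ (shift (coeff p) m)))

  ∑ℤ< : ℕ → (ℕ → ℤ) → ℤ
  ∑ℤ< zero    f = + 0
  ∑ℤ< (suc L) f = f 0 + ∑ℤ< L (f ∘ suc)

  syntax ∑ℤ< L (λ k → e) = ∑ℤ[ k < L ] e

  ∑ℤ<-cong-< : ∀ L {f g : ℕ → ℤ} → (∀ k → k < L → f k ≡ g k) → ∑ℤ< L f ≡ ∑ℤ< L g
  ∑ℤ<-cong-< zero    h = refl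
  ∑ℤ<-cong-< (suc L) h = cong₂ _+_ (h 0 (s≤s z≤n)) (∑ℤ<-cong-< L (λ k k<L → h (suc k) (s≤s k<L)))

  ∑ℤ<-cong : ∀ L {f g : ℕ → ℤ} → (∀ k → f k ≡ g k) → ∑ℤ< L f ≡ ∑ℤ< L g
  ∑ℤ<-cong L h = ∑ℤ<-cong-< L (λ k _ → h k)

  ∑ℤ<-zero : ∀ L → ∑ℤ[ k < L ] (+ 0) ≡ + 0
  ∑ℤ<-zero zero    = refl
  ∑ℤ<-zero (suc L) = trans (+-identityˡ _) (∑ℤ<-zero L)

  ∑ℤ<-snoc : ∀ L (f : ℕ → ℤ) → ∑ℤ< (suc L) f ≡ ∑ℤ< L f + f L
  ∑ℤ<-snoc zero    f = trans (+-identityʳ (f 0)) (sym (+-identityˡ (f 0)))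
  ∑ℤ<-snoc (suc L) f = trans (cong (_+_ (f 0)) (∑ℤ<-snoc L (f ∘ suc))) (sym (+-assoc (f 0) _ _))

  sumℤ-applyUpTo : ∀ L (g : ℕ → ℕ) (f : ℕ → ℤ) → sumℤ (map f (applyUpTo g L)) ≡ ∑ℤ< L (f ∘ g)
  sumℤ-applyUpTo zero    g f = refl
  sumℤ-applyUpTo (suc L) g f = cong (_+_ (f (g 0))) (sumℤ-applyUpTo L (g ∘ suc) f)

  ∑ℤ<-convolution : ∀ p s m → ∑ℤ[ i < suc m ] (coeff p i * s (m ∸ i)) ≡ (p *ₛ s) m
  ∑ℤ<-convolution []      s m = trans (∑ℤ<-cong (suc m) (λ i → *-zeroˡ (s (m ∸ i)))) (∑ℤ<-zero (suc m))
  ∑ℤ<-convolution (a ∷ p) s m = cong (_+_ (a * s m)) (begin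
    ∑ℤ[ i < m ] (coeff p i * s (m ∸ suc i))                               ≡⟨ ∑ℤ<-cong-< m (λ i i<m → cong (λ k → coeff p i * shift s k) (sym (ℕ.+-∸-assoc 1 i<m))) ⟩
    ∑ℤ[ i < m ] (coeff p i * shift s (m ∸ i))                             ≡⟨ sym (+-identityʳ _) ⟩
    ∑ℤ[ i < m ] (coeff p i * shift s (m ∸ i)) + + 0                       ≡⟨ cong (_+_ (∑ℤ[ i < m ] (coeff p i * shift s (m ∸ i)))) last-vanishes ⟩
    ∑ℤ[ i < m ] (coeff p i * shift s (m ∸ i)) + coeff p m * shift s (m ∸ m) ≡⟨ sym (∑ℤ<-snoc m _) ⟩
    ∑ℤ[ i < suc m ] (coeff p i * shift s (m ∸ i))                         ≡⟨ ∑ℤ<-convolution p (shift s) m ⟩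
    (p *ₛ shift s) m                                                      ∎)
    where
    open ≡-Reasoning
    last-vanishes : + 0 ≡ coeff p m * shift s (m ∸ m)
    last-vanishes = sym (trans (cong (λ k → coeff p m * shift s k) (ℕ.n∸n≡0 m)) (*-zeroʳ (coeff p m)))

  mulPS≡*ₛ : ∀ p s m → mulPS p s m ≡ (p *ₛ s) m
  mulPS≡*ₛ p s m = trans (sumℤ-applyUpTo (suc m) id (λ i → coeff p i * s (m ∸ i))) (∑ℤ<-convolution p s m)

  binomialSeries : ℕ → Series
  binomialSeries k m = + (m C k)

  oneMinusX-*ₛ-binomialSeries : ∀ k → oneMinusX *ₛ binomialSeries (suc k) ≗ shift (binomialSeries k)
  oneMinusX-*ₛ-binomialSeries k zero    = refl
  oneMinusX-*ₛ-binomialSeries k (suc m) = begin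
    + 1 * + (suc m C suc k) + (- + 1 * + (m C suc k) + + 0)   ≡⟨ cong (λ c → + 1 * + c + (- + 1 * + (m C suc k) + + 0)) (sym (nCk+nC[k+1]≡[n+1]C[k+1] m k)) ⟩
    + 1 * + (m C k ℕ.+ m C suc k) + (- + 1 * + (m C suc k) + + 0) ≡⟨ cong (λ c → + 1 * c + (- + 1 * + (m C suc k) + + 0)) (pos-+ (m C k) _) ⟩
    + 1 * (+ (m C k) + + (m C suc k)) + (- + 1 * + (m C suc k) + + 0) ≡⟨ cancel (+ (m C k)) (+ (m C suc k)) ⟩
    + (m C k)                                                 ∎
    where
    open ≡-Reasoning
    cancel : ∀ x y → + 1 * (x + y) + (- + 1 * y + + 0) ≡ x
    cancel = solve-∀

  oneMinusX-*ₛ-binomialSeries-0 : oneMinusX *ₛ binomialSeries 0 ≗ coeff (+ 1 ∷ [])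
  oneMinusX-*ₛ-binomialSeries-0 zero    = refl
  oneMinusX-*ₛ-binomialSeries-0 (suc m) = refl

  binomialSeries-generating : ∀ k → (oneMinusX ^ₚ suc k) *ₛ binomialSeries k ≗ coeff (Xpow k)
  binomialSeries-generating zero m =
    trans (*ₚ-*ₛ oneMinusX (+ 1 ∷ []) (binomialSeries 0) m)
          (trans (*ₛ-cong oneMinusX (*ₛ-identityˡ (binomialSeries 0)) m) (oneMinusX-*ₛ-binomialSeries-0 m))
  binomialSeries-generating (suc k) m = begin
    ((oneMinusX *ₚ P) *ₛ binomialSeries (suc k)) m     ≡⟨ *ₚ-*ₛ oneMinusX P (binomialSeries (suc k)) m ⟩
    (oneMinusX *ₛ (P *ₛ binomialSeries (suc k))) m     ≡⟨ *ₛ-comm oneMinusX P (binomialSeries (suc k)) m ⟩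
    (P *ₛ (oneMinusX *ₛ binomialSeries (suc k))) m     ≡⟨ *ₛ-cong P (oneMinusX-*ₛ-binomialSeries k) m ⟩
    (P *ₛ shift (binomialSeries k)) m                  ≡⟨ *ₛ-shift P (binomialSeries k) m ⟩
    shift (P *ₛ binomialSeries k) m                    ≡⟨ shift-cong (binomialSeries-generating k) m ⟩
    shift (coeff (Xpow k)) m                           ≡⟨ sym (coeff-0∷ (Xpow k) m) ⟩
    coeff (Xpow (suc k)) m                             ∎
    where
    open ≡-Reasoning
    P = oneMinusX ^ₚ suc k

  *ₛ-∑ℤ< : ∀ p L (c : ℕ → ℤ) (t : ℕ → Series) →
    p *ₛ (λ k → ∑ℤ[ j < L ] (c j * t j k)) ≗ (λ m → ∑ℤ[ j < L ] (c j * (p *ₛ t j) m))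
  *ₛ-∑ℤ< p zero    c t m = *ₛ-zeroʳ p m
  *ₛ-∑ℤ< p (suc L) c t m =
    trans (*ₛ-distribˡ-+ p (λ k → c 0 * t 0 k) (λ k → ∑ℤ[ j < L ] (c (suc j) * t (suc j) k)) m)
          (cong₂ _+_ (*ₛ-scaleʳ p (c 0) (t 0) m) (*ₛ-∑ℤ< p L (c ∘ suc) (t ∘ suc) m))

  ∑ℤ<-shift : ∀ L (c : ℕ → ℤ) (t : ℕ → Series) → ∀ m → ∑ℤ[ j < L ] (c j * shift (t j) m) ≡ shift (λ m → ∑ℤ[ j < L ] (c j * t j m)) m
  ∑ℤ<-shift L c t zero    = trans (∑ℤ<-cong L (λ j → *-zeroʳ (c j))) (∑ℤ<-zero L)
  ∑ℤ<-shift L c t (suc m) = refl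

  pos-∑< : ∀ L (f : ℕ → ℕ) → + Counting.∑< L f ≡ ∑ℤ[ k < L ] (+ f k)
  pos-∑< zero    f = refl
  pos-∑< (suc L) f = trans (pos-+ (f 0) _) (cong (_+_ (+ f 0)) (pos-∑< L (f ∘ suc)))

  coeff-*ₚ-Xpow-suc : ∀ p i → coeff (p *ₚ Xpow (suc i)) ≗ shift (coeff (p *ₚ Xpow i))
  coeff-*ₚ-Xpow-suc p i m = begin
    coeff (p *ₚ Xpow (suc i)) m         ≡⟨ coeff-*ₚ p (Xpow (suc i)) m ⟩
    (p *ₛ coeff (+ 0 ∷ Xpow i)) m       ≡⟨ *ₛ-cong p (coeff-0∷ (Xpow i)) m ⟩
    (p *ₛ shift (coeff (Xpow i))) m     ≡⟨ *ₛ-shift p (coeff (Xpow i)) m ⟩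
    shift (p *ₛ coeff (Xpow i)) m       ≡⟨ shift-cong (sym ∘ coeff-*ₚ p (Xpow i)) m ⟩
    shift (coeff (p *ₚ Xpow i)) m       ∎
    where open ≡-Reasoning

  binomial-term : ∀ D j → j < suc D →
    (oneMinusX ^ₚ suc D) *ₛ binomialSeries j ≗ coeff ((oneMinusX ^ₚ (D ∸ j)) *ₚ Xpow j)
  binomial-term D j (s≤s j≤D) m = begin
    ((oneMinusX ^ₚ suc D) *ₛ binomialSeries j) m                          ≡⟨ cong (λ e → ((oneMinusX ^ₚ e) *ₛ binomialSeries j) m) exponents ⟩
    ((oneMinusX ^ₚ ((D ∸ j) ℕ.+ suc j)) *ₛ binomialSeries j) m            ≡⟨ ^ₚ-*ₛ oneMinusX (D ∸ j) (suc j) (binomialSeries j) m ⟩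
    (Q *ₛ ((oneMinusX ^ₚ suc j) *ₛ binomialSeries j)) m                   ≡⟨ *ₛ-cong Q (binomialSeries-generating j) m ⟩
    (Q *ₛ coeff (Xpow j)) m                                               ≡⟨ sym (coeff-*ₚ Q (Xpow j) m) ⟩
    coeff (Q *ₚ Xpow j) m                                                 ∎
    where
    open ≡-Reasoning
    Q = oneMinusX ^ₚ (D ∸ j)
    exponents : suc D ≡ (D ∸ j) ℕ.+ suc j
    exponents = trans (cong suc (sym (ℕ.m∸n+n≡m j≤D))) (sym (ℕ.+-suc (D ∸ j) j))

module HPolynomial where

  open import Data.Integer using (+_; _+_; _*_)
  open import Data.Integer.Properties using (+-identityʳ; +-identityˡ; pos-*; *-comm)
  open import Data.Nat as ℕ using (_∸_)
  open import Data.Nat.Combinatorics using (_C_)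
  open import Data.Fin.Properties using (punchIn-injective)
  open import Data.List using (upTo)
  open import Data.List.Properties using (map-∘)
  open Counting using (∑; ⟦_⟧; ∑<)
  open ImageCounting using (count-by-image)
  open CellCounts
  open PowerSeries

  tail-binomial-expansion : ∀ {n} (𝒜 : List (FlatRel (suc n))) → Embedded 𝒜 → ∀ k →
    + k * Tail 𝒜 (+ k) ≡ ∑ℤ[ j < suc (suc (dA 𝒜)) ] (+ cellCount 𝒜 j * binomialSeries j k)
  tail-binomial-expansion {n} 𝒜 emb k = begin
    + k * Tail 𝒜 (+ k)                                       ≡⟨ tail-count proper k ⟩
    + ∑[ c ← allFuns (suc n) k ] ⟦ inUnion 𝒜 c ⟧              ≡⟨ cong +_ (count-by-image (inUnion 𝒜) inUnion-punchIn D (cellCount-vanishes 𝒜 flats) k) ⟩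
    + ∑[ j < D ] ((k C j) ℕ.* cellCount 𝒜 j)                  ≡⟨ pos-∑< D (λ j → (k C j) ℕ.* cellCount 𝒜 j) ⟩
    ∑ℤ[ j < D ] (+ ((k C j) ℕ.* cellCount 𝒜 j))               ≡⟨ ∑ℤ<-cong D (λ j → trans (pos-* (k C j) _) (*-comm (+ (k C j)) (+ cellCount 𝒜 j))) ⟩
    ∑ℤ[ j < D ] (+ cellCount 𝒜 j * binomialSeries j k)        ∎
    where
    open ≡-Reasoning
    open Embedded emb
    open IntersectionLattice 𝒜 flats using (module Möbius)
    open Möbius (s≤s z≤n) using (tail-count)
    D = suc (suc (dA 𝒜))
    inUnion-punchIn : ∀ {m} (v : Fin (suc m)) (c : Vec (Fin m) (suc n)) → inUnion 𝒜 (Vec.map (punchIn v) c) ≡ inUnion 𝒜 c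
    inUnion-punchIn v = inUnion-map-injective 𝒜 (punchIn-injective v _ _)

  hTerm : ℕ → ℕ → Poly
  hTerm d i = (oneMinusX ^ₚ (d ∸ i)) *ₚ Xpow i

  coeff-hbar : ∀ {n} (A : FlatRel n) (𝒜 : List (FlatRel n)) m →
    coeff (hbar (A ∷ 𝒜)) m ≡ ∑ℤ[ i < suc (dA (A ∷ 𝒜)) ] (+ fm1 (A ∷ 𝒜) i * coeff (hTerm (dA (A ∷ 𝒜)) i) m)
  coeff-hbar A 𝒜 m = begin
    coeff (sumPoly (map F (upTo (suc d)))) m                 ≡⟨ coeff-sumPoly (map F (upTo (suc d))) m ⟩
    sumℤ (map (λ q → coeff q m) (map F (upTo (suc d))))      ≡⟨ cong sumℤ (sym (map-∘ {g = λ q → coeff q m} {f = F} (upTo (suc d)))) ⟩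
    sumℤ (map (λ i → coeff (F i) m) (upTo (suc d)))          ≡⟨ sumℤ-applyUpTo (suc d) id (λ i → coeff (F i) m) ⟩
    ∑ℤ[ i < suc d ] coeff (F i) m                            ≡⟨ ∑ℤ<-cong (suc d) (λ i → trans (coeff-*ₚ (constₚ (+ fm1 (A ∷ 𝒜) i)) (hTerm d i) m) (+-identityʳ (+ fm1 (A ∷ 𝒜) i * coeff (hTerm d i) m))) ⟩
    ∑ℤ[ i < suc d ] (+ fm1 (A ∷ 𝒜) i * coeff (hTerm d i) m)  ∎
    where
    open ≡-Reasoning
    d = dA (A ∷ 𝒜)
    F : ℕ → Poly
    F i = constₚ (+ fm1 (A ∷ 𝒜) i) *ₚ hTerm d i

  -- cellCount 𝒜 j counts the cells with j blocks, i.e. it is f_{j-2} for j ≥ 2, while it is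
  -- 1 = f_{-1} for j = 1 and 0 for j = 0: so the j-th term is the (j-1)-st term of h̄ times x.
  x·hbar-coefficient : ∀ {n} (𝒜 : List (FlatRel (suc n))) m →
    ∑ℤ[ j < suc (suc (dA 𝒜)) ] (+ cellCount 𝒜 j * coeff (hTerm (suc (dA 𝒜)) j) m) ≡ coeff (Xpow 1 *ₚ hbar 𝒜) m
  x·hbar-coefficient {n} [] m = begin
    ∑ℤ[ j < 2 ] (+ cellCount {suc n} [] j * coeff (hTerm 1 j) m)
                                                        ≡⟨ ∑ℤ<-cong 2 (λ j → cong (λ c → + c * coeff (hTerm 1 j) m) (cellCount-[] {suc n} j)) ⟩
    ∑ℤ[ j < 2 ] (+ 0)                                   ≡⟨ ∑ℤ<-zero 2 ⟩
    + 0                                                 ≡⟨ sym (trans (coeff-x* [] m) (shift-[] m)) ⟩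
    coeff (Xpow 1 *ₚ []) m                              ∎
    where
    open ≡-Reasoning
    shift-[] : ∀ m → shift (coeff []) m ≡ + 0
    shift-[] zero    = refl
    shift-[] (suc m) = refl
  x·hbar-coefficient (A ∷ 𝒜) m = begin
    + cellCount (A ∷ 𝒜) 0 * coeff (hTerm (suc d) 0) m + ∑ℤ[ i < suc d ] (+ cellCount (A ∷ 𝒜) (suc i) * coeff (hTerm (suc d) (suc i)) m)
      ≡⟨ cong₂ _+_ (cong (λ c → + c * coeff (hTerm (suc d) 0) m) (cellCount-zero (A ∷ 𝒜)))
                   (∑ℤ<-cong (suc d) (λ i → cong₂ (λ c x → + c * x) (cellCount≡fm1 i) (coeff-*ₚ-Xpow-suc (oneMinusX ^ₚ (d ∸ i)) i m))) ⟩
    + 0 + ∑ℤ[ i < suc d ] (+ fm1 (A ∷ 𝒜) i * shift (coeff (hTerm d i)) m)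
      ≡⟨ +-identityˡ _ ⟩
    ∑ℤ[ i < suc d ] (+ fm1 (A ∷ 𝒜) i * shift (coeff (hTerm d i)) m)
      ≡⟨ ∑ℤ<-shift (suc d) (λ i → + fm1 (A ∷ 𝒜) i) (λ i → coeff (hTerm d i)) m ⟩
    shift (λ m′ → ∑ℤ[ i < suc d ] (+ fm1 (A ∷ 𝒜) i * coeff (hTerm d i) m′)) m
      ≡⟨ shift-cong (sym ∘ coeff-hbar A 𝒜) m ⟩
    shift (coeff (hbar (A ∷ 𝒜))) m
      ≡⟨ sym (coeff-x* (hbar (A ∷ 𝒜)) m) ⟩
    coeff (Xpow 1 *ₚ hbar (A ∷ 𝒜)) m ∎
    where
    open ≡-Reasoning
    d = dA (A ∷ 𝒜)
    cellCount≡fm1 : ∀ i → cellCount (A ∷ 𝒜) (suc i) ≡ fm1 (A ∷ 𝒜) i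
    cellCount≡fm1 zero    = cellCount-one A 𝒜
    cellCount≡fm1 (suc i) = refl

open import Data.Nat using (ℕ; _≤_; _+_)
open import Data.Nat.Properties using (+-comm)
open import Data.Integer using (+_; _*_)
open PowerSeries using (mulPS≡*ₛ; _*ₛ_; *ₛ-cong; *ₛ-∑ℤ<; ∑ℤ<; ∑ℤ<-cong-<; binomialSeries; binomial-term)
open HPolynomial using (tail-binomial-expansion; hTerm; x·hbar-coefficient)

theorem5p5 : (n : ℕ) → 1 ≤ n → (𝒜 : List (FlatRel n)) → Embedded 𝒜 →
    (m : ℕ) →
    mulPS (oneMinusX ^ₚ (dA 𝒜 + 2)) (λ k → (+ k) * Tail 𝒜 (+ k)) m
      ≡ coeff (Xpow 1 *ₚ hbar 𝒜) m
theorem5p5 (suc n) _ 𝒜 emb m = begin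
  mulPS (oneMinusX ^ₚ (dA 𝒜 + 2)) s m                          ≡⟨ cong (λ e → mulPS (oneMinusX ^ₚ e) s m) (+-comm (dA 𝒜) 2) ⟩
  mulPS P s m                                                   ≡⟨ mulPS≡*ₛ P s m ⟩
  (P *ₛ s) m                                                    ≡⟨ *ₛ-cong P (tail-binomial-expansion 𝒜 emb) m ⟩
  (P *ₛ (λ k → ∑ℤ[ j < D ] (+ g j * binomialSeries j k))) m     ≡⟨ *ₛ-∑ℤ< P D (λ j → + g j) binomialSeries m ⟩
  ∑ℤ[ j < D ] (+ g j * (P *ₛ binomialSeries j) m)               ≡⟨ ∑ℤ<-cong-< D (λ j j<D → cong (λ x → + g j * x) (binomial-term (suc (dA 𝒜)) j j<D m)) ⟩
  ∑ℤ[ j < D ] (+ g j * coeff (hTerm (suc (dA 𝒜)) j) m)          ≡⟨ x·hbar-coefficient 𝒜 m ⟩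
  coeff (Xpow 1 *ₚ hbar 𝒜) m                                    ∎
  where
  open ≡-Reasoning
  D = suc (suc (dA 𝒜))
  P = oneMinusX ^ₚ D
  g = cellCount 𝒜
  s : ℕ → ℤ
  s k = (+ k) * Tail 𝒜 (+ k)
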